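{- Let $G_n$ ($n\ge1$) be the linear crossed polyomino chain with $n$ four-order complete graphs. Then $$\lim_{n\to\infty}\frac{K\!f(G_n)}{W(G_n)}=\frac14.$$
   Context: For $n\geq1$, $G_n$ is the simple graph with vertex set $\{1,\ldots,n+1\}\cup\{1',\ldots,(n+1)'\}$ and edge set consisting of the vertical edges $ii'$ for $1\le i\le n+1$ together with, for each $1\le i\le n$, the edges $i(i+1)$, $i'(i+1)'$, $i(i+1)'$, $i'(i+1)$. $W(G)=\sum_{\{u,v\}}d(u,v)$ is the Wiener index (sum of shortest-path distances over unordered pairs of distinct vertices), and $K\!f(G)=\sum_{\{u,v\}} r_{uv}$ is the Kirchhoff index, where $r_{uv}$ is the effective resistance between $u$ and $v$ when every edge is a unit resistor. -}

module Defs where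

open import Data.Bool using (Bool; true; false; _∧_; _∨_; not; if_then_else_)
open import Data.Nat as ℕ using (ℕ; zero; suc; _∸_; _/_)
open import Data.Fin using (Fin; toℕ)
open import Data.List using (List; []; _∷_; foldr; map)
open import Data.Bool.ListAction using (any)
open import Data.Fin using () renaming (_≟_ to _≟ᶠ_)
open import Data.List using (allFin)
open import Data.Integer using (+_)
open import Data.Rational as ℚ using (ℚ; 0ℚ)
open import Data.Product using (Σ; _×_; _,_)
open import Relation.Binary.PropositionalEquality using (_≡_)
open import Relation.Nullary.Decidable using (⌊_⌋)

-- A finite simple graph on vertex set Fin m, given by its (symmetric,
-- irreflexive) adjacency predicate.
Graph : ℕ → Set
Graph m = Fin m → Fin m → Bool

nV : ℕ → ℕ
nV n = 2 ℕ.* suc n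

-- Vertex k ∈ Fin (2(n+1)) encodes layer i = ⌊k/2⌋ ∈ {0..n} (i.e. vertex i+1
-- or (i+1)' of the paper) and side k mod 2 (unprimed / primed).
layer : ∀ {m} → Fin m → ℕ
layer k = toℕ k / 2

near : ℕ → ℕ → Bool
near a b = ⌊ (a ∸ b) ℕ.≤? 1 ⌋ ∧ ⌊ (b ∸ a) ℕ.≤? 1 ⌋

-- Edges of G_n: ii' (same layer, distinct vertices) and all four edges
-- i(i+1), i'(i+1)', i(i+1)', i'(i+1) between consecutive layers.
G : (n : ℕ) → Graph (nV n)
G n u v = not ⌊ u ≟ᶠ v ⌋ ∧ near (layer u) (layer v)

reach : ∀ {m} → Graph m → ℕ → Fin m → Fin m → Bool
reach g zero    u v = ⌊ u ≟ᶠ v ⌋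
reach g (suc k) u v = reach g k u v ∨ any (λ w → reach g k u w ∧ g w v) (allFin _)

search : ∀ {m} → Graph m → Fin m → Fin m → (fuel start : ℕ) → ℕ
search g u v zero       start = start
search g u v (suc fuel) start =
  if reach g start u v then start else search g u v fuel (suc start)

-- d(u,v): the least k such that u and v are joined by a walk of length ≤ k
-- (in a connected graph on m vertices, k ≤ m - 1 so fuel m suffices).
dist : ∀ {m} → Graph m → Fin m → Fin m → ℕ
dist {m} g u v = search g u v m 0

pairs : (m : ℕ) → List (Fin m × Fin m)
pairs m = foldr (λ u acc → foldr (λ v acc' →
            if ⌊ toℕ u ℕ.<? toℕ v ⌋ then (u , v) ∷ acc' else acc') acc (allFin m))
          [] (allFin m)

sumℕ : List ℕ → ℕ
sumℕ = foldr ℕ._+_ 0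

sumℚ : List ℚ → ℚ
sumℚ = foldr ℚ._+_ 0ℚ

wiener : ∀ {m} → Graph m → ℕ
wiener {m} g = sumℕ (map (λ { (u , v) → dist g u v }) (pairs m))

indicator : Bool → ℚ
indicator true  = ℚ.1ℚ
indicator false = 0ℚ

-- φ is a potential for a unit current injected at s and extracted at t:
-- for every vertex w, the net current flowing out of w,
-- Σ_{x ~ w} (φ w - φ x), equals [w = s] - [w = t]  (Kirchhoff's laws + Ohm).
IsUnitCurrentPotential : ∀ {m} → Graph m → Fin m → Fin m → (Fin m → ℚ) → Set
IsUnitCurrentPotential {m} g s t φ =
  ∀ w → sumℚ (map (λ x → indicator (g w x) ℚ.* (φ w ℚ.- φ x)) (allFin m))
        ≡ indicator ⌊ w ≟ᶠ s ⌋ ℚ.- indicator ⌊ w ≟ᶠ t ⌋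

-- r is the effective resistance between s and t: the potential difference
-- φ s - φ t for such a potential (unique on a connected graph).
IsEffectiveResistance : ∀ {m} → Graph m → Fin m → Fin m → ℚ → Set
IsEffectiveResistance g s t r =
  Σ (_ → ℚ) λ φ → IsUnitCurrentPotential g s t φ × (r ≡ φ s ℚ.- φ t)

kirchhoff : ∀ {m} → (Fin m → Fin m → ℚ) → ℚ
kirchhoff {m} r = sumℚ (map (λ { (u , v) → r u v }) (pairs m))

-- x / w for w : ℕ (w ≠ 0); conventionally 0 when w = 0 (never used: W(G_n) > 0)
divℕ : ℚ → ℕ → ℚ
divℕ x zero    = 0ℚ
divℕ x (suc k) = x ℚ.* (+ 1 ℚ./ suc k)

module Submission where

-- Vertex c ∈ {0, …, 2n+1} of G_n lies in layer ⌊c/2⌋, and two distinct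
-- vertices are adjacent iff their layers differ by at most one.
--  1. Distances: d(u,v) = max(1, |layer u - layer v|) (dist-G).  Summing,
--     3 W(G_n) = n P + 3(n+1)², P the number of vertex pairs (wiener-vs-pairs).
--  2. Resistances: on any undirected graph two unit-current potentials
--     have the same drop between the poles, by Green's identity
--     (potential-difference-unique).  For G_n we exhibit one explicitly, a
--     ramp falling by ¼ per layer plus weighted dipoles at the two poles
--     (flowPotential-unit-current), and read off r(u,v) = d(u,v)/4 + e with
--     0 ≤ e ≤ ¼ (excess-bounded).
--  3. Summing over pairs, K = W/4 + E with 0 ≤ E ≤ P/4, hence
--     |K/W - ¼| = E/W ≤ 3/(4n) (ratio-close), which tends to 0.
-- The file follows this order: finite sums, layers and distances, the
-- Wiener index, electrical networks on arbitrary graphs, the explicit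
-- potential on G_n, and the final estimate.

open import Level using (0ℓ)
open import Algebra.Bundles using (CommutativeMonoid; CommutativeRing)
open import Algebra.Structures using (IsCommutativeMonoid)
import Algebra.Properties.CommutativeMonoid.Sum as MonoidSum
open import Data.Bool using (true; false; T; _∧_; _∨_; not; if_then_else_)
open import Data.Bool.Properties using (T-∧; T-∨; ∧-zeroʳ; ∧-comm)
open import Data.Empty using (⊥-elim)
open import Data.Fin as Fin using (Fin; toℕ)
open import Data.Fin using () renaming (_≟_ to _≟ᶠ_)
import Data.Fin.Properties as Finₚ
import Data.Integer as ℤ
import Data.Integer.Properties as ℤₚ
open import Data.List using ([]; _∷_; foldr; map; allFin; tabulate)
open import Data.List.Relation.Unary.All using (All; []; _∷_)
open import Data.List.Relation.Unary.Any.Properties using (any⁺; any⁻; tabulate⁺; tabulate⁻)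
open import Data.Nat as ℕ using (ℕ; zero; suc; _∸_; _⊔_; ∣_-_∣; _≤_; _<_; z≤n; s≤s)
import Data.Nat.Properties as ℕₚ
import Data.Nat.DivMod as ℕ÷
open import Data.Nat.Coprimality using (1-coprimeTo) renaming (sym to Coprime-sym)
open import Data.Nat.Tactic.RingSolver using (solve-∀)
open import Data.Product using (∃; _×_; _,_; proj₁; proj₂)
open import Data.Rational as ℚ using (ℚ; mkℚ; 0ℚ; 1ℚ; _+_; _*_; _-_; -_; _/_)
import Data.Rational.Properties as ℚₚ
open import Data.Rational.Solver using (module +-*-Solver)
open +-*-Solver using (solve; _:+_; _:*_; _:-_; :-_; _:=_; con)
import Data.Rational.Unnormalised as ℚᵘ
import Data.Rational.Unnormalised.Properties as ℚᵘₚ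
open import Algebra.Properties.Semiring.Sum (CommutativeRing.semiring ℚₚ.+-*-commutativeRing)
  using (*-distribˡ-sum)
open import Data.Sum using (_⊎_; inj₁; inj₂)
open import Function using (_∘_; id)
open import Function.Bundles using (Equivalence)
open Equivalence using (to; from)
open import Relation.Binary.Definitions using (Tri; tri<; tri≈; tri>)
open import Relation.Binary.PropositionalEquality
open import Relation.Nullary using (Dec; yes; no; ¬_)
open import Relation.Nullary.Decidable using (⌊_⌋; True; toWitness; fromWitness; fromWitnessFalse)

open import Defs

⌊⌋-true : ∀ {P : Set} (d : Dec P) → P → ⌊ d ⌋ ≡ true
⌊⌋-true (yes _) _ = refl
⌊⌋-true (no ¬p) p = ⊥-elim (¬p p)

⌊⌋-false : ∀ {P : Set} (d : Dec P) → ¬ P → ⌊ d ⌋ ≡ false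
⌊⌋-false (yes p) ¬p = ⊥-elim (¬p p)
⌊⌋-false (no _)  _  = refl

<?-suc : ∀ a b → ⌊ suc a ℕ.<? suc b ⌋ ≡ ⌊ a ℕ.<? b ⌋
<?-suc a b with a ℕ.<? b
... | yes a<b = ⌊⌋-true (suc a ℕ.<? suc b) (s≤s a<b)
... | no  a≮b = ⌊⌋-false (suc a ℕ.<? suc b) (λ sa<sb → a≮b (ℕ.s≤s⁻¹ sa<sb))

-- Range sums are Fin-sums of f ∘ toℕ, so peeling off the first term
-- shifts the summand: Σ< (suc m) f = f 0 ∙ Σ< m (f ∘ suc) definitionally.
module Sums {A : Set} {_∙_ : A → A → A} {ε : A}
            (isCM : IsCommutativeMonoid _≡_ _∙_ ε) where

  open IsCommutativeMonoid isCM using (assoc; identityˡ; identityʳ)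

  monoid : CommutativeMonoid 0ℓ 0ℓ
  monoid = record { isCommutativeMonoid = isCM }

  open MonoidSum monoid public using (sum; sum-cong-≗; ∑-distrib-+; ∑-comm)

  Σ< : ℕ → (ℕ → A) → A
  Σ< m f = sum {m} (f ∘ toℕ)

  foldr-tabulate : ∀ {B : Set} {m} (h : B → A) (f : Fin m → B) →
    foldr _∙_ ε (map h (tabulate f)) ≡ sum (h ∘ f)
  foldr-tabulate {m = zero}  h f = refl
  foldr-tabulate {m = suc m} h f = cong (h (f Fin.zero) ∙_) (foldr-tabulate h (f ∘ Fin.suc))

  foldr-allFin : ∀ {m} (h : Fin m → A) → foldr _∙_ ε (map h (allFin m)) ≡ sum h
  foldr-allFin h = foldr-tabulate h id

  Σ<-cong : ∀ m {f g : ℕ → A} → (∀ a → a < m → f a ≡ g a) → Σ< m f ≡ Σ< m g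
  Σ<-cong m f≡g = sum-cong-≗ (λ i → f≡g (toℕ i) (Finₚ.toℕ<n i))

  Σ<-last : ∀ m (f : ℕ → A) → Σ< (suc m) f ≡ Σ< m f ∙ f m
  Σ<-last zero    f = trans (identityʳ (f 0)) (sym (identityˡ (f 0)))
  Σ<-last (suc m) f = trans (cong (f 0 ∙_) (Σ<-last m (f ∘ suc))) (sym (assoc _ _ _))

  Σ<-pairs : ∀ l (f : ℕ → A) → Σ< (l ℕ.* 2) f ≡ Σ< l (λ p → f (p ℕ.* 2) ∙ f (suc (p ℕ.* 2)))
  Σ<-pairs zero    f = refl
  Σ<-pairs (suc l) f = trans (sym (assoc _ _ _)) (cong (_ ∙_) (Σ<-pairs l (f ∘ suc ∘ suc)))

  foldr-pairs : ∀ {m} (h : Fin m × Fin m → A) →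
    foldr _∙_ ε (map h (pairs m))
      ≡ sum (λ u → sum (λ v → if ⌊ toℕ u ℕ.<? toℕ v ⌋ then h (u , v) else ε))
  foldr-pairs {m} h = trans (outer (allFin m))
    (trans (foldr-allFin (λ u → foldr _∙_ ε (map (cond u) (allFin m))))
      (sum-cong-≗ (λ u → foldr-allFin (cond u))))
    where
    cond : Fin m → Fin m → A
    cond u v = if ⌊ toℕ u ℕ.<? toℕ v ⌋ then h (u , v) else ε
    inner : ∀ u L acc →
      foldr _∙_ ε (map h (foldr (λ v acc' → if ⌊ toℕ u ℕ.<? toℕ v ⌋ then (u , v) ∷ acc' else acc') acc L))
        ≡ foldr _∙_ ε (map (cond u) L) ∙ foldr _∙_ ε (map h acc)
    inner u []      acc = sym (identityˡ _)
    inner u (v ∷ L) acc with ⌊ toℕ u ℕ.<? toℕ v ⌋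
    ... | true  = trans (cong (h (u , v) ∙_) (inner u L acc)) (sym (assoc _ _ _))
    ... | false = trans (inner u L acc) (cong (_∙ _) (sym (identityˡ _)))
    outer : ∀ L → foldr _∙_ ε (map h (foldr (λ u acc → foldr (λ v acc' →
                    if ⌊ toℕ u ℕ.<? toℕ v ⌋ then (u , v) ∷ acc' else acc') acc (allFin m)) [] L))
                ≡ foldr _∙_ ε (map (λ u → foldr _∙_ ε (map (cond u) (allFin m))) L)
    outer []      = refl
    outer (u ∷ L) = trans (inner u (allFin m) _) (cong (_ ∙_) (outer L))

  Σ<-triangle : ∀ m (X : ℕ → ℕ → A) →
    Σ< m (λ a → Σ< m (λ b → if ⌊ a ℕ.<? b ⌋ then X a b else ε)) ≡ Σ< m (λ b → Σ< b (λ a → X a b))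
  Σ<-triangle zero    X = refl
  Σ<-triangle (suc m) X = begin
      (ε ∙ Σ< m (λ b → X 0 (suc b)))
        ∙ Σ< m (λ a → ε ∙ Σ< m (λ b → if ⌊ suc a ℕ.<? suc b ⌋ then X (suc a) (suc b) else ε))
    ≡⟨ cong₂ _∙_ (identityˡ _) (sum-cong-≗ {m} (λ a → trans (identityˡ _)
         (sum-cong-≗ {m} (λ b → cong (λ c → if c then X (suc (toℕ a)) (suc (toℕ b)) else ε) (<?-suc (toℕ a) (toℕ b)))))) ⟩
      Σ< m (λ b → X 0 (suc b)) ∙ Σ< m (λ a → Σ< m (λ b → if ⌊ a ℕ.<? b ⌋ then X (suc a) (suc b) else ε))
    ≡⟨ cong (Σ< m (λ b → X 0 (suc b)) ∙_) (Σ<-triangle m (λ a b → X (suc a) (suc b))) ⟩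
      Σ< m (λ b → X 0 (suc b)) ∙ Σ< m (λ b → Σ< b (λ a → X (suc a) (suc b)))
    ≡⟨ sym (∑-distrib-+ {m} (λ i → X 0 (suc (toℕ i))) (λ i → Σ< (toℕ i) (λ a → X (suc a) (suc (toℕ i))))) ⟩
      Σ< m (λ b → Σ< (suc b) (λ a → X a (suc b)))
    ≡⟨ sym (identityˡ _) ⟩
      ε ∙ Σ< m (λ b → Σ< (suc b) (λ a → X a (suc b)))
    ∎
    where open ≡-Reasoning

open Sums ℕₚ.+-0-isCommutativeMonoid using (Σ<; Σ<-cong; Σ<-last; Σ<-pairs; Σ<-triangle)
  renaming (sum to Σℕ; sum-cong-≗ to Σℕ-cong; ∑-distrib-+ to Σℕ-distrib; foldr-pairs to sumℕ-pairs)

layer-even : ∀ l → (l ℕ.* 2) ℕ./ 2 ≡ l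
layer-even l = ℕ÷.m*n/n≡m l 2

layer-odd : ∀ l → suc (l ℕ.* 2) ℕ./ 2 ≡ l
layer-odd l = begin
    suc (l ℕ.* 2) ℕ./ 2           ≡⟨ cong (ℕ._/ 2) (ℕₚ.+-comm 1 (l ℕ.* 2)) ⟩
    (l ℕ.* 2 ℕ.+ 1) ℕ./ 2         ≡⟨ ℕ÷.+-distrib-/ (l ℕ.* 2) 1 rem<2 ⟩
    (l ℕ.* 2) ℕ./ 2 ℕ.+ 1 ℕ./ 2   ≡⟨ cong (ℕ._+ 0) (layer-even l) ⟩
    l ℕ.+ 0                       ≡⟨ ℕₚ.+-identityʳ l ⟩
    l                             ∎
  where
  open ≡-Reasoning
  rem<2 : (l ℕ.* 2) ℕ.% 2 ℕ.+ 1 ℕ.% 2 < 2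
  rem<2 = subst (λ r → r ℕ.+ 1 < 2) (sym (ℕ÷.m*n%n≡0 l 2)) ℕₚ.≤-refl

layer≤ : ∀ n (u : Fin (nV n)) → layer u ≤ n
layer≤ n u = ℕ.s≤s⁻¹ (ℕ÷.m<n*o⇒m/o<n (subst (toℕ u <_) (ℕₚ.*-comm 2 (suc n)) (Finₚ.toℕ<n u)))

odd-vertex< : ∀ n l → l ≤ n → suc (l ℕ.* 2) < nV n
odd-vertex< n l l≤n = subst (suc l ℕ.* 2 ≤_) (ℕₚ.*-comm (suc n) 2) (ℕₚ.*-monoˡ-≤ 2 (s≤s l≤n))

even-vertex< : ∀ n l → l ≤ n → l ℕ.* 2 < nV n
even-vertex< n l l≤n = ℕₚ.<-trans (ℕₚ.n<1+n (l ℕ.* 2)) (odd-vertex< n l l≤n)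

evenVertex oddVertex : ∀ n l → l ≤ n → Fin (nV n)
evenVertex n l l≤n = Fin.fromℕ< (even-vertex< n l l≤n)
oddVertex  n l l≤n = Fin.fromℕ< (odd-vertex< n l l≤n)

layer-evenVertex : ∀ n l (l≤n : l ≤ n) → layer (evenVertex n l l≤n) ≡ l
layer-evenVertex n l l≤n = trans (cong (ℕ._/ 2) (Finₚ.toℕ-fromℕ< (even-vertex< n l l≤n))) (layer-even l)

layer-oddVertex : ∀ n l (l≤n : l ≤ n) → layer (oddVertex n l l≤n) ≡ l
layer-oddVertex n l l≤n = trans (cong (ℕ._/ 2) (Finₚ.toℕ-fromℕ< (odd-vertex< n l l≤n))) (layer-odd l)

other-vertex-in-layer : ∀ n l → l ≤ n → (v : Fin (nV n)) → ∃ λ w → layer w ≡ l × ¬ w ≡ v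
other-vertex-in-layer n l l≤n v with evenVertex n l l≤n ≟ᶠ v
... | no  even≢v = evenVertex n l l≤n , layer-evenVertex n l l≤n , even≢v
... | yes even≡v = oddVertex n l l≤n , layer-oddVertex n l l≤n , odd≢v
  where
  odd≢v : ¬ oddVertex n l l≤n ≡ v
  odd≢v odd≡v = ℕₚ.1+n≢n (sym (begin
      l ℕ.* 2                      ≡⟨ sym (Finₚ.toℕ-fromℕ< (even-vertex< n l l≤n)) ⟩
      toℕ (evenVertex n l l≤n)     ≡⟨ cong toℕ (trans even≡v (sym odd≡v)) ⟩
      toℕ (oddVertex n l l≤n)      ≡⟨ Finₚ.toℕ-fromℕ< (odd-vertex< n l l≤n) ⟩
      suc (l ℕ.* 2)                ∎))
    where open ≡-Reasoning

reach-refl : ∀ {m} (g : Graph m) k u → T (reach g k u u)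
reach-refl g zero    u = fromWitness refl
reach-refl g (suc k) u = from (T-∨ {reach g k u u}) (inj₁ (reach-refl g k u))

reach-step : ∀ {m} (g : Graph m) k u w v → T (reach g k u w) → T (g w v) → T (reach g (suc k) u v)
reach-step g k u w v r e =
  from (T-∨ {reach g k u v}) (inj₂ (any⁺ _ (tabulate⁺ w (from (T-∧ {reach g k u w}) (r , e)))))

reach-last : ∀ {m} (g : Graph m) k u v → T (reach g (suc k) u v) →
  T (reach g k u v) ⊎ ∃ λ w → T (reach g k u w) × T (g w v)
reach-last g k u v r with to (T-∨ {reach g k u v}) r
... | inj₁ r′ = inj₁ r′
... | inj₂ a with tabulate⁻ (any⁻ _ _ a)
...   | w , p = inj₂ (w , to (T-∧ {reach g k u w}) p)

search-finds : ∀ {m} (g : Graph m) u v fuel start D → start ≤ D → D < start ℕ.+ fuel →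
  (∀ k → k < D → ¬ T (reach g k u v)) → T (reach g D u v) → search g u v fuel start ≡ D
search-finds g u v zero start D s≤D D<s _ _ =
  ⊥-elim (ℕₚ.<-irrefl refl (ℕₚ.<-≤-trans D<s (subst (_≤ D) (sym (ℕₚ.+-identityʳ start)) s≤D)))
search-finds g u v (suc fuel) start D s≤D D<s unreached reached
  with reach g start u v in found | ℕₚ.m≤n⇒m<n∨m≡n s≤D
... | true  | inj₂ s≡D = s≡D
... | true  | inj₁ s<D = ⊥-elim (unreached start s<D (subst T (sym found) _))
... | false | inj₂ refl = ⊥-elim (subst T found reached)
... | false | inj₁ s<D = search-finds g u v fuel (suc start) D s<D
                           (subst (D <_) (ℕₚ.+-suc start fuel) D<s) unreached reached

near⁺ : ∀ a b → ∣ a - b ∣ ≤ 1 → T (near a b)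
near⁺ a b d≤1 = from (T-∧ {⌊ a ∸ b ℕ.≤? 1 ⌋})
  ( fromWitness (ℕₚ.≤-trans (ℕₚ.m∸n≤∣m-n∣ a b) d≤1)
  , fromWitness (ℕₚ.≤-trans (ℕₚ.m∸n≤∣m-n∣ b a) (subst (_≤ 1) (ℕₚ.∣-∣-comm a b) d≤1)) )

near⁻ : ∀ a b → T (near a b) → ∣ a - b ∣ ≤ 1
near⁻ a b t with to (T-∧ {⌊ a ∸ b ℕ.≤? 1 ⌋}) t | ℕₚ.∣m-n∣≡[m∸n]∨[n∸m] a b
... | p , _ | inj₁ d≡a∸b = subst (_≤ 1) (sym d≡a∸b) (toWitness p)
... | _ , q | inj₂ d≡b∸a = subst (_≤ 1) (sym d≡b∸a) (toWitness q)

G-adjacent : ∀ n (w v : Fin (nV n)) → ¬ w ≡ v → ∣ layer w - layer v ∣ ≤ 1 → T (G n w v)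
G-adjacent n w v w≢v d≤1 = from (T-∧ {not ⌊ w ≟ᶠ v ⌋}) (fromWitnessFalse w≢v , near⁺ (layer w) (layer v) d≤1)

G-adjacent⁻¹ : ∀ n (w v : Fin (nV n)) → T (G n w v) → ∣ layer w - layer v ∣ ≤ 1
G-adjacent⁻¹ n w v e = near⁻ (layer w) (layer v) (proj₂ (to (T-∧ {not ⌊ w ≟ᶠ v ⌋}) e))

reach-sound : ∀ n k (u v : Fin (nV n)) → T (reach (G n) k u v) →
  u ≡ v ⊎ (1 ≤ k × ∣ layer u - layer v ∣ ≤ k)
reach-sound n zero u v r = inj₁ (toWitness r)
reach-sound n (suc k) u v r with reach-last (G n) k u v r
... | inj₁ r′ with reach-sound n k u v r′
...   | inj₁ u≡v       = inj₁ u≡v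
...   | inj₂ (_ , d≤k) = inj₂ (s≤s z≤n , ℕₚ.m≤n⇒m≤1+n d≤k)
reach-sound n (suc k) u v r | inj₂ (w , r′ , e) with reach-sound n k u w r′
...   | inj₁ refl      = inj₂ (s≤s z≤n , ℕₚ.≤-trans (G-adjacent⁻¹ n w v e) (s≤s z≤n))
...   | inj₂ (_ , d≤k) = inj₂ (s≤s z≤n , ℕₚ.≤-trans (ℕₚ.∣-∣-triangle (layer u) (layer w) (layer v))
                            (ℕₚ.≤-trans (ℕₚ.+-mono-≤ d≤k (G-adjacent⁻¹ n w v e)) (ℕₚ.≤-reflexive (ℕₚ.+-comm k 1))))

∣n-1+n∣≤1 : ∀ n → ∣ n - suc n ∣ ≤ 1
∣n-1+n∣≤1 zero    = ℕₚ.≤-refl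
∣n-1+n∣≤1 (suc n) = ∣n-1+n∣≤1 n

step-towards : ∀ x y k → ∣ x - y ∣ ≤ suc k → ∃ λ z → ∣ x - z ∣ ≤ k × ∣ z - y ∣ ≤ 1 × z ≤ x ⊔ y
step-towards zero    zero    k _ = 0 , z≤n , z≤n , z≤n
step-towards zero    (suc y) k d = y , ℕ.s≤s⁻¹ d , ∣n-1+n∣≤1 y , ℕₚ.n≤1+n y
step-towards (suc x) zero    k d = 1 , subst (_≤ k) (sym (ℕₚ.∣-∣-identityʳ x)) (ℕ.s≤s⁻¹ d) , ℕₚ.≤-refl , s≤s z≤n
step-towards (suc x) (suc y) k d with step-towards x y k d
... | z , d₁ , d₂ , z≤ = suc z , d₁ , d₂ , s≤s z≤

reach-complete : ∀ n k (u v : Fin (nV n)) → ∣ layer u - layer v ∣ ≤ suc k → T (reach (G n) (suc k) u v)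
reach-complete n zero u v d≤1 = one-step (u ≟ᶠ v)
  where
  one-step : Dec (u ≡ v) → T (reach (G n) 1 u v)
  one-step (yes refl) = reach-refl (G n) 1 u
  one-step (no u≢v)   = reach-step (G n) 0 u u v (reach-refl (G n) 0 u) (G-adjacent n u v u≢v d≤1)
reach-complete n (suc k) u v d with step-towards (layer u) (layer v) (suc k) d
... | z , d₁ , d₂ , z≤ with other-vertex-in-layer n z (ℕₚ.≤-trans z≤ (ℕₚ.⊔-lub (layer≤ n u) (layer≤ n v))) v
...   | w , refl , w≢v = reach-step (G n) (suc k) u w v (reach-complete n k u w d₁) (G-adjacent n w v w≢v d₂)

layerDist : ℕ → ℕ → ℕ
layerDist x y = 1 ⊔ ∣ x - y ∣

dist-G : ∀ n {u v : Fin (nV n)} → ¬ u ≡ v → dist (G n) u v ≡ layerDist (layer u) (layer v)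
dist-G n {u} {v} u≢v = search-finds (G n) u v (nV n) 0 D z≤n D<fuel unreached reached
  where
  D : ℕ
  D = layerDist (layer u) (layer v)
  -- D ≤ n + 1 < 2(n + 1), so the search has enough fuel
  D<fuel : D < nV n
  D<fuel = ℕₚ.≤-trans (s≤s (ℕₚ.⊔-lub (s≤s z≤n) (ℕₚ.≤-trans (ℕₚ.∣m-n∣≤m⊔n (layer u) (layer v))
             (ℕₚ.≤-trans (ℕₚ.⊔-lub (layer≤ n u) (layer≤ n v)) (ℕₚ.n≤1+n n)))))
           (s≤s (ℕₚ.≤-trans (ℕₚ.m≤n+m (suc n) n) (ℕₚ.+-monoʳ-≤ n (ℕₚ.m≤m+n (suc n) 0))))
  reached : T (reach (G n) D u v)
  reached with ∣ layer u - layer v ∣ in d≡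
  ... | zero  = reach-complete n 0 u v (ℕₚ.≤-trans (ℕₚ.≤-reflexive d≡) z≤n)
  ... | suc d = reach-complete n d u v (ℕₚ.≤-reflexive d≡)
  unreached : ∀ k → k < D → ¬ T (reach (G n) k u v)
  unreached k k<D r with reach-sound n k u v r
  ... | inj₁ u≡v         = u≢v u≡v
  ... | inj₂ (1≤k , d≤k) = ℕₚ.<-irrefl refl (ℕₚ.<-≤-trans k<D (ℕₚ.⊔-lub 1≤k d≤k))

distancesBelow : ℕ → ℕ
distancesBelow b = Σ< b (λ a → layerDist (a ℕ./ 2) (b ℕ./ 2))

wiener-by-vertex : ∀ n → wiener (G n) ≡ Σ< (nV n) distancesBelow
wiener-by-vertex n = begin
    wiener (G n)
  ≡⟨ sumℕ-pairs {nV n} (λ p → dist (G n) (proj₁ p) (proj₂ p)) ⟩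
    Σℕ (λ u → Σℕ (λ v → if ⌊ toℕ u ℕ.<? toℕ v ⌋ then dist (G n) u v else 0))
  ≡⟨ Σℕ-cong (λ u → Σℕ-cong (λ v → dist-if-ordered u v)) ⟩
    Σ< (nV n) (λ a → Σ< (nV n) (λ b → if ⌊ a ℕ.<? b ⌋ then layerDist (a ℕ./ 2) (b ℕ./ 2) else 0))
  ≡⟨ Σ<-triangle (nV n) (λ a b → layerDist (a ℕ./ 2) (b ℕ./ 2)) ⟩
    Σ< (nV n) distancesBelow
  ∎
  where
  open ≡-Reasoning
  dist-if-ordered : ∀ u v → (if ⌊ toℕ u ℕ.<? toℕ v ⌋ then dist (G n) u v else 0)
                          ≡ (if ⌊ toℕ u ℕ.<? toℕ v ⌋ then layerDist (layer u) (layer v) else 0)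
  dist-if-ordered u v with toℕ u ℕ.<? toℕ v
  ... | yes u<v = dist-G n (λ u≡v → ℕₚ.<-irrefl (cong toℕ u≡v) u<v)
  ... | no  _   = refl

layerDist-below : ∀ p l → p < l → layerDist p l ≡ l ∸ p
layerDist-below p l p<l =
  trans (cong (1 ⊔_) (ℕₚ.m≤n⇒∣m-n∣≡n∸m (ℕₚ.<⇒≤ p<l))) (ℕₚ.m≤n⇒m⊔n≡n (ℕₚ.m<n⇒0<n∸m p<l))

triangular : ∀ l → 2 ℕ.* Σ< l (λ p → l ∸ p) ≡ l ℕ.* suc l
triangular zero    = refl
triangular (suc l) = begin
    2 ℕ.* (suc l ℕ.+ Σ< l (λ p → l ∸ p))
  ≡⟨ ℕₚ.*-distribˡ-+ 2 (suc l) _ ⟩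
    2 ℕ.* suc l ℕ.+ 2 ℕ.* Σ< l (λ p → l ∸ p)
  ≡⟨ cong (2 ℕ.* suc l ℕ.+_) (triangular l) ⟩
    2 ℕ.* suc l ℕ.+ l ℕ.* suc l
  ≡⟨ arith l ⟩
    suc l ℕ.* suc (suc l) ∎
  where
  open ≡-Reasoning
  arith : ∀ l → 2 ℕ.* suc l ℕ.+ l ℕ.* suc l ≡ suc l ℕ.* suc (suc l)
  arith = solve-∀

-- From vertex 2l: two vertices in each of the layers p < l, at distance l - p.
distancesBelow-even : ∀ l → distancesBelow (l ℕ.* 2) ≡ l ℕ.* suc l
distancesBelow-even l = begin
    Σ< (l ℕ.* 2) (λ a → layerDist (a ℕ./ 2) ((l ℕ.* 2) ℕ./ 2))
  ≡⟨ Σ<-pairs l (λ a → layerDist (a ℕ./ 2) L) ⟩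
    Σ< l (λ p → layerDist ((p ℕ.* 2) ℕ./ 2) L ℕ.+ layerDist (suc (p ℕ.* 2) ℕ./ 2) L)
  ≡⟨ Σ<-cong l (λ p p<l → cong₂ ℕ._+_ (below (layer-even p) p<l) (below (layer-odd p) p<l)) ⟩
    Σ< l (λ p → (l ∸ p) ℕ.+ (l ∸ p))
  ≡⟨ Σℕ-distrib {l} (λ p → l ∸ toℕ p) (λ p → l ∸ toℕ p) ⟩
    Σ< l (λ p → l ∸ p) ℕ.+ Σ< l (λ p → l ∸ p)
  ≡⟨ cong (Σ< l (λ p → l ∸ p) ℕ.+_) (sym (ℕₚ.+-identityʳ (Σ< l (λ p → l ∸ p)))) ⟩
    2 ℕ.* Σ< l (λ p → l ∸ p)
  ≡⟨ triangular l ⟩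
    l ℕ.* suc l ∎
  where
  open ≡-Reasoning
  L : ℕ
  L = (l ℕ.* 2) ℕ./ 2
  below : ∀ {c p} → c ≡ p → p < l → layerDist c L ≡ l ∸ p
  below {p = p} refl p<l = trans (cong (layerDist p) (layer-even l)) (layerDist-below p l p<l)

-- From vertex 2l+1: as from 2l, plus the partner 2l at distance 1.
distancesBelow-odd : ∀ l → distancesBelow (suc (l ℕ.* 2)) ≡ l ℕ.* suc l ℕ.+ 1
distancesBelow-odd l = begin
    Σ< (suc (l ℕ.* 2)) (λ a → layerDist (a ℕ./ 2) L)
  ≡⟨ Σ<-last (l ℕ.* 2) (λ a → layerDist (a ℕ./ 2) L) ⟩
    Σ< (l ℕ.* 2) (λ a → layerDist (a ℕ./ 2) L) ℕ.+ layerDist ((l ℕ.* 2) ℕ./ 2) L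
  ≡⟨ cong₂ ℕ._+_ (trans (cong (λ z → Σ< (l ℕ.* 2) (λ a → layerDist (a ℕ./ 2) z)) same-layer)
                        (distancesBelow-even l))
                 (cong (λ z → 1 ⊔ ∣ z - L ∣) (sym same-layer) ) ⟩
    l ℕ.* suc l ℕ.+ (1 ⊔ ∣ L - L ∣)
  ≡⟨ cong (λ z → l ℕ.* suc l ℕ.+ (1 ⊔ z)) (ℕₚ.∣n-n∣≡0 L) ⟩
    l ℕ.* suc l ℕ.+ 1 ∎
  where
  open ≡-Reasoning
  L : ℕ
  L = suc (l ℕ.* 2) ℕ./ 2
  same-layer : L ≡ (l ℕ.* 2) ℕ./ 2
  same-layer = trans (layer-odd l) (sym (layer-even l))

wiener-closed : ∀ n → 3 ℕ.* wiener (G n) ≡ suc n ℕ.* (2 ℕ.* (suc n ℕ.* suc n) ℕ.+ 1)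
wiener-closed n = begin
    3 ℕ.* wiener (G n)
  ≡⟨ cong (3 ℕ.*_) (trans (wiener-by-vertex n) (cong (λ m → Σ< m distancesBelow) (ℕₚ.*-comm 2 (suc n)))) ⟩
    3 ℕ.* Σ< (suc n ℕ.* 2) distancesBelow
  ≡⟨ cong (3 ℕ.*_) (trans (Σ<-pairs (suc n) distancesBelow)
       (Σ<-cong (suc n) (λ l _ → cong₂ ℕ._+_ (distancesBelow-even l) (distancesBelow-odd l)))) ⟩
    3 ℕ.* Σ< (suc n) layerPair
  ≡⟨ closed (suc n) ⟩
    suc n ℕ.* (2 ℕ.* (suc n ℕ.* suc n) ℕ.+ 1) ∎
  where
  open ≡-Reasoning
  layerPair : ℕ → ℕ
  layerPair l = l ℕ.* suc l ℕ.+ (l ℕ.* suc l ℕ.+ 1)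
  closed : ∀ N → 3 ℕ.* Σ< N layerPair ≡ N ℕ.* (2 ℕ.* (N ℕ.* N) ℕ.+ 1)
  closed zero    = refl
  closed (suc N) = begin
      3 ℕ.* Σ< (suc N) layerPair
    ≡⟨ cong (3 ℕ.*_) (Σ<-last N layerPair) ⟩
      3 ℕ.* (Σ< N layerPair ℕ.+ layerPair N)
    ≡⟨ ℕₚ.*-distribˡ-+ 3 (Σ< N layerPair) (layerPair N) ⟩
      3 ℕ.* Σ< N layerPair ℕ.+ 3 ℕ.* layerPair N
    ≡⟨ cong (ℕ._+ 3 ℕ.* layerPair N) (closed N) ⟩
      N ℕ.* (2 ℕ.* (N ℕ.* N) ℕ.+ 1) ℕ.+ 3 ℕ.* layerPair N
    ≡⟨ step N ⟩
      suc N ℕ.* (2 ℕ.* (suc N ℕ.* suc N) ℕ.+ 1) ∎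
    where
    step : ∀ m → m ℕ.* (2 ℕ.* (m ℕ.* m) ℕ.+ 1) ℕ.+ 3 ℕ.* (m ℕ.* suc m ℕ.+ (m ℕ.* suc m ℕ.+ 1))
               ≡ suc m ℕ.* (2 ℕ.* (suc m ℕ.* suc m) ℕ.+ 1)
    step = solve-∀

pair-count : ∀ n → sumℕ (map (λ _ → 1) (pairs (nV n))) ≡ suc n ℕ.* suc (2 ℕ.* n)
pair-count n = begin
    sumℕ (map (λ _ → 1) (pairs (nV n)))
  ≡⟨ sumℕ-pairs {nV n} (λ _ → 1) ⟩
    Σ< (nV n) (λ a → Σ< (nV n) (λ b → if ⌊ a ℕ.<? b ⌋ then 1 else 0))
  ≡⟨ Σ<-triangle (nV n) (λ _ _ → 1) ⟩
    Σ< (nV n) (λ b → Σ< b (λ _ → 1))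
  ≡⟨ Σ<-cong (nV n) (λ b _ → count b) ⟩
    Σ< (nV n) (λ b → b)
  ≡⟨ cong (λ m → Σ< m (λ b → b)) (ℕₚ.*-comm 2 (suc n)) ⟩
    Σ< (suc n ℕ.* 2) (λ b → b)
  ≡⟨ Σ<-pairs (suc n) (λ b → b) ⟩
    Σ< (suc n) (λ l → l ℕ.* 2 ℕ.+ suc (l ℕ.* 2))
  ≡⟨ closed n ⟩
    suc n ℕ.* suc (2 ℕ.* n) ∎
  where
  open ≡-Reasoning
  count : ∀ b → Σ< b (λ _ → 1) ≡ b
  count zero    = refl
  count (suc b) = cong suc (count b)
  closed : ∀ N → Σ< (suc N) (λ l → l ℕ.* 2 ℕ.+ suc (l ℕ.* 2)) ≡ suc N ℕ.* suc (2 ℕ.* N)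
  closed zero    = refl
  closed (suc N) = trans (Σ<-last (suc N) (λ l → l ℕ.* 2 ℕ.+ suc (l ℕ.* 2))) (trans (cong (ℕ._+ (suc N ℕ.* 2 ℕ.+ suc (suc N ℕ.* 2))) (closed N)) (arith N))
    where
    arith : ∀ m → suc m ℕ.* suc (2 ℕ.* m) ℕ.+ (suc m ℕ.* 2 ℕ.+ suc (suc m ℕ.* 2))
                ≡ suc (suc m) ℕ.* suc (2 ℕ.* suc m)
    arith = solve-∀

-- Electrical networks on an arbitrary finite graph.

open Sums ℚₚ.+-0-isCommutativeMonoid using ()
  renaming (sum to Σℚ; sum-cong-≗ to Σℚ-cong; ∑-distrib-+ to Σℚ-distrib; ∑-comm to Σℚ-comm;
            foldr-allFin to sumℚ-allFin; Σ< to Σℚ<; Σ<-cong to Σℚ<-cong; Σ<-pairs to Σℚ<-pairs)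

laplacian : ∀ {m} → Graph m → (Fin m → ℚ) → Fin m → ℚ
laplacian g φ w = Σℚ (λ x → indicator (g w x) * (φ w - φ x))

source : ∀ {m} → Fin m → Fin m → Fin m → ℚ
source s t w = indicator ⌊ w ≟ᶠ s ⌋ - indicator ⌊ w ≟ᶠ t ⌋

Σℚ-sub : ∀ {m} (f h : Fin m → ℚ) → Σℚ (λ x → f x - h x) ≡ Σℚ f - Σℚ h
Σℚ-sub {zero}  f h = refl
Σℚ-sub {suc m} f h = begin
    (f₀ - h₀) + Σℚ (λ x → f (Fin.suc x) - h (Fin.suc x))
  ≡⟨ cong ((f₀ - h₀) +_) (Σℚ-sub (f ∘ Fin.suc) (h ∘ Fin.suc)) ⟩
    (f₀ - h₀) + (Σℚ (f ∘ Fin.suc) - Σℚ (h ∘ Fin.suc))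
  ≡⟨ solve 4 (λ a b c d → (a :- b) :+ (c :- d) := (a :+ c) :- (b :+ d)) refl f₀ h₀ _ _ ⟩
    (f₀ + Σℚ (f ∘ Fin.suc)) - (h₀ + Σℚ (h ∘ Fin.suc)) ∎
  where
  open ≡-Reasoning
  f₀ = f Fin.zero
  h₀ = h Fin.zero

Σℚ-zeros : ∀ {m} {f : Fin m → ℚ} → (∀ x → f x ≡ 0ℚ) → Σℚ f ≡ 0ℚ
Σℚ-zeros {zero}  f≡0 = refl
Σℚ-zeros {suc m} f≡0 = trans (cong₂ _+_ (f≡0 Fin.zero) (Σℚ-zeros (f≡0 ∘ Fin.suc))) (ℚₚ.+-identityʳ 0ℚ)

Σℚ-point : ∀ {m} (f : Fin m → ℚ) s → Σℚ (λ w → f w * indicator ⌊ w ≟ᶠ s ⌋) ≡ f s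
Σℚ-point {suc m} f Fin.zero = begin
    f Fin.zero * 1ℚ + Σℚ (λ w → f (Fin.suc w) * indicator ⌊ Fin.suc w ≟ᶠ Fin.zero ⌋)
  ≡⟨ cong₂ _+_ (ℚₚ.*-identityʳ (f Fin.zero)) (Σℚ-cong {m} (λ w → ℚₚ.*-zeroʳ (f (Fin.suc w)))) ⟩
    f Fin.zero + Σℚ {m} (λ _ → 0ℚ)
  ≡⟨ cong (f Fin.zero +_) (Σℚ-zeros {m} (λ _ → refl)) ⟩
    f Fin.zero + 0ℚ
  ≡⟨ ℚₚ.+-identityʳ _ ⟩
    f Fin.zero ∎
  where open ≡-Reasoning
Σℚ-point {suc m} f (Fin.suc s) = begin
    f Fin.zero * 0ℚ + Σℚ (λ w → f (Fin.suc w) * indicator ⌊ Fin.suc w ≟ᶠ Fin.suc s ⌋)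
  ≡⟨ cong₂ _+_ (ℚₚ.*-zeroʳ (f Fin.zero)) (Σℚ-cong {m} (λ w → cong (λ b → f (Fin.suc w) * indicator b) (suc-≟ w))) ⟩
    0ℚ + Σℚ (λ w → f (Fin.suc w) * indicator ⌊ w ≟ᶠ s ⌋)
  ≡⟨ trans (ℚₚ.+-identityˡ _) (Σℚ-point (f ∘ Fin.suc) s) ⟩
    f (Fin.suc s) ∎
  where
  open ≡-Reasoning
  suc-≟ : ∀ w → ⌊ Fin.suc w ≟ᶠ Fin.suc s ⌋ ≡ ⌊ w ≟ᶠ s ⌋
  suc-≟ w with w ≟ᶠ s
  ... | yes _ = refl
  ... | no  _ = refl

Σℚ-source : ∀ {m} (ψ : Fin m → ℚ) s t → Σℚ (λ w → ψ w * source s t w) ≡ ψ s - ψ t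
Σℚ-source ψ s t = begin
    Σℚ (λ w → ψ w * source s t w)
  ≡⟨ Σℚ-cong (λ w → solve 3 (λ p a b → p :* (a :- b) := (p :* a) :- (p :* b)) refl (ψ w) _ _) ⟩
    Σℚ (λ w → ψ w * indicator ⌊ w ≟ᶠ s ⌋ - ψ w * indicator ⌊ w ≟ᶠ t ⌋)
  ≡⟨ Σℚ-sub (λ w → ψ w * indicator ⌊ w ≟ᶠ s ⌋) (λ w → ψ w * indicator ⌊ w ≟ᶠ t ⌋) ⟩
    Σℚ (λ w → ψ w * indicator ⌊ w ≟ᶠ s ⌋) - Σℚ (λ w → ψ w * indicator ⌊ w ≟ᶠ t ⌋)
  ≡⟨ cong₂ _-_ (Σℚ-point ψ s) (Σℚ-point ψ t) ⟩
    ψ s - ψ t ∎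
  where open ≡-Reasoning

pairing-expand : ∀ {m} (g : Graph m) (φ ψ : Fin m → ℚ) →
  Σℚ (λ w → ψ w * laplacian g φ w)
    ≡ Σℚ (λ w → Σℚ (λ x → indicator (g w x) * (φ w * ψ w)))
      - Σℚ (λ w → Σℚ (λ x → indicator (g w x) * (ψ w * φ x)))
pairing-expand g φ ψ = trans (Σℚ-cong (λ w → begin
      ψ w * laplacian g φ w
    ≡⟨ *-distribˡ-sum (ψ w) (λ x → indicator (g w x) * (φ w - φ x)) ⟩
      Σℚ (λ x → ψ w * (indicator (g w x) * (φ w - φ x)))
    ≡⟨ Σℚ-cong (λ x → solve 4 (λ p e a b → p :* (e :* (a :- b)) := (e :* (a :* p)) :- (e :* (p :* b)))
                          refl (ψ w) (indicator (g w x)) (φ w) (φ x)) ⟩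
      Σℚ (λ x → indicator (g w x) * (φ w * ψ w) - indicator (g w x) * (ψ w * φ x))
    ≡⟨ Σℚ-sub (λ x → indicator (g w x) * (φ w * ψ w)) (λ x → indicator (g w x) * (ψ w * φ x)) ⟩
      Σℚ (λ x → indicator (g w x) * (φ w * ψ w)) - Σℚ (λ x → indicator (g w x) * (ψ w * φ x)) ∎))
  (Σℚ-sub (λ w → Σℚ (λ x → indicator (g w x) * (φ w * ψ w)))
          (λ w → Σℚ (λ x → indicator (g w x) * (ψ w * φ x))))
  where open ≡-Reasoning

green : ∀ {m} (g : Graph m) → (∀ x y → g x y ≡ g y x) → (φ ψ : Fin m → ℚ) →
  Σℚ (λ w → ψ w * laplacian g φ w) ≡ Σℚ (λ w → φ w * laplacian g ψ w)
green g g-sym φ ψ = begin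
    Σℚ (λ w → ψ w * laplacian g φ w)
  ≡⟨ pairing-expand g φ ψ ⟩
    Σℚ (λ w → Σℚ (λ x → e w x * (φ w * ψ w))) - Σℚ (λ w → Σℚ (λ x → e w x * (ψ w * φ x)))
  ≡⟨ cong₂ _-_ (Σℚ-cong (λ w → Σℚ-cong (λ x → cong (e w x *_) (ℚₚ.*-comm (φ w) (ψ w))))) cross-term ⟩
    Σℚ (λ w → Σℚ (λ x → e w x * (ψ w * φ w))) - Σℚ (λ w → Σℚ (λ x → e w x * (φ w * ψ x)))
  ≡⟨ sym (pairing-expand g ψ φ) ⟩
    Σℚ (λ w → φ w * laplacian g ψ w) ∎
  where
  open ≡-Reasoning
  e : _ → _ → ℚ
  e w x = indicator (g w x)
  cross-term : Σℚ (λ w → Σℚ (λ x → e w x * (ψ w * φ x))) ≡ Σℚ (λ w → Σℚ (λ x → e w x * (φ w * ψ x)))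
  cross-term = trans (Σℚ-comm (λ w x → e w x * (ψ w * φ x)))
    (Σℚ-cong (λ x → Σℚ-cong (λ w → cong₂ _*_ (cong indicator (g-sym w x)) (ℚₚ.*-comm (ψ w) (φ x)))))

-- Two unit-current potentials between s and t on an undirected graph
-- have the same potential difference: effective resistance is well defined.
potential-difference-unique : ∀ {m} (g : Graph m) → (∀ x y → g x y ≡ g y x) → ∀ s t (φ ψ : Fin m → ℚ) →
  IsUnitCurrentPotential g s t φ → IsUnitCurrentPotential g s t ψ → φ s - φ t ≡ ψ s - ψ t
potential-difference-unique g g-sym s t φ ψ φ-unit ψ-unit = begin
    φ s - φ t                           ≡⟨ sym (Σℚ-source φ s t) ⟩
    Σℚ (λ w → φ w * source s t w)       ≡⟨ Σℚ-cong (λ w → cong (φ w *_) (sym (Δψ w))) ⟩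
    Σℚ (λ w → φ w * laplacian g ψ w)    ≡⟨ sym (green g g-sym φ ψ) ⟩
    Σℚ (λ w → ψ w * laplacian g φ w)    ≡⟨ Σℚ-cong (λ w → cong (ψ w *_) (Δφ w)) ⟩
    Σℚ (λ w → ψ w * source s t w)       ≡⟨ Σℚ-source ψ s t ⟩
    ψ s - ψ t                           ∎
  where
  open ≡-Reasoning
  Δφ : ∀ w → laplacian g φ w ≡ source s t w
  Δφ w = trans (sym (sumℚ-allFin (λ x → indicator (g w x) * (φ w - φ x)))) (φ-unit w)
  Δψ : ∀ w → laplacian g ψ w ≡ source s t w
  Δψ w = trans (sym (sumℚ-allFin (λ x → indicator (g w x) * (ψ w - ψ x)))) (ψ-unit w)

-- The Laplacian of G_n, computed layer by layer.  Potentials on G_n are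
-- given as functions H of the vertex index; at a vertex of layer k only
-- the layers k-1, k, k+1 contribute.

prevLayer : ℕ → (ℕ → ℚ) → ℚ
prevLayer zero    Y = 0ℚ
prevLayer (suc k) Y = Y k

nextLayer : ℕ → ℕ → (ℕ → ℚ) → ℚ
nextLayer N k Y = if ⌊ suc k ℕ.<? N ⌋ then Y (suc k) else 0ℚ

nextLayer-suc : ∀ N k Y → nextLayer (suc N) (suc k) Y ≡ nextLayer N k (Y ∘ suc)
nextLayer-suc N k Y = cong (λ b → if b then Y (suc (suc k)) else 0ℚ) (<?-suc (suc k) N)

-- Summing Y over the layers l < N adjacent or equal to k; by induction on
-- k, using that near (k+1) (l+1) = near k l by computation.
window : ∀ N k (Y : ℕ → ℚ) → k < N →
  Σℚ< N (λ l → indicator (near k l) * Y l) ≡ prevLayer k Y + Y k + nextLayer N k Y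
window (suc zero)     zero Y _ = solve 1 (λ y → con 1ℚ :* y :+ con 0ℚ := con 0ℚ :+ y :+ con 0ℚ) refl (Y 0)
window (suc (suc N))  zero Y _ = begin
    1ℚ * Y 0 + (1ℚ * Y 1 + Σℚ< N (λ l → 0ℚ * Y (suc (suc l))))
  ≡⟨ cong (λ z → 1ℚ * Y 0 + (1ℚ * Y 1 + z)) (Σℚ-zeros {N} (λ l → ℚₚ.*-zeroˡ (Y (suc (suc (toℕ l)))))) ⟩
    1ℚ * Y 0 + (1ℚ * Y 1 + 0ℚ)
  ≡⟨ solve 2 (λ a b → con 1ℚ :* a :+ (con 1ℚ :* b :+ con 0ℚ) := con 0ℚ :+ a :+ b) refl (Y 0) (Y 1) ⟩
    0ℚ + Y 0 + Y 1 ∎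
  where open ≡-Reasoning
window (suc N) (suc zero) Y 1<N = begin
    1ℚ * Y 0 + Σℚ< N (λ l → indicator (near 0 l) * Y (suc l))
  ≡⟨ cong (1ℚ * Y 0 +_) (window N 0 (Y ∘ suc) (ℕ.s≤s⁻¹ 1<N)) ⟩
    1ℚ * Y 0 + (0ℚ + Y 1 + nextLayer N 0 (Y ∘ suc))
  ≡⟨ solve 3 (λ a b c → con 1ℚ :* a :+ (con 0ℚ :+ b :+ c) := a :+ b :+ c) refl (Y 0) (Y 1) _ ⟩
    Y 0 + Y 1 + nextLayer N 0 (Y ∘ suc)
  ≡⟨ cong (Y 0 + Y 1 +_) (sym (nextLayer-suc N 0 Y)) ⟩
    Y 0 + Y 1 + nextLayer (suc N) 1 Y ∎
  where open ≡-Reasoning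
window (suc N) (suc (suc k)) Y k<N = begin
    0ℚ * Y 0 + Σℚ< N (λ l → indicator (near (suc k) l) * Y (suc l))
  ≡⟨ cong (0ℚ * Y 0 +_) (window N (suc k) (Y ∘ suc) (ℕ.s≤s⁻¹ k<N)) ⟩
    0ℚ * Y 0 + (Y (suc k) + Y (suc (suc k)) + nextLayer N (suc k) (Y ∘ suc))
  ≡⟨ solve 4 (λ a b c d → con 0ℚ :* a :+ (b :+ c :+ d) := b :+ c :+ d) refl (Y 0) (Y (suc k)) _ _ ⟩
    Y (suc k) + Y (suc (suc k)) + nextLayer N (suc k) (Y ∘ suc)
  ≡⟨ cong (Y (suc k) + Y (suc (suc k)) +_) (sym (nextLayer-suc N (suc k) Y)) ⟩
    Y (suc k) + Y (suc (suc k)) + nextLayer (suc N) (suc (suc k)) Y ∎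
  where open ≡-Reasoning

pairDrop : (ℕ → ℚ) → ℕ → ℕ → ℚ
pairDrop H c l = (H c - H (l ℕ.* 2)) + (H c - H (suc (l ℕ.* 2)))

laplacian-by-layers : ∀ n (H : ℕ → ℚ) (w : Fin (nV n)) →
  laplacian (G n) (H ∘ toℕ) w
    ≡ prevLayer (layer w) (pairDrop H (toℕ w)) + pairDrop H (toℕ w) (layer w)
      + nextLayer (suc n) (layer w) (pairDrop H (toℕ w))
laplacian-by-layers n H w = begin
    Σℚ (λ x → indicator (G n w x) * (H c - H (toℕ x)))
  ≡⟨ Σℚ-cong (λ x → self-loop-free x) ⟩
    Σℚ< (nV n) F
  ≡⟨ cong (λ m → Σℚ< m F) (ℕₚ.*-comm 2 (suc n)) ⟩
    Σℚ< (suc n ℕ.* 2) F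
  ≡⟨ Σℚ<-pairs (suc n) F ⟩
    Σℚ< (suc n) (λ l → F (l ℕ.* 2) + F (suc (l ℕ.* 2)))
  ≡⟨ Σℚ<-cong (suc n) (λ l _ → by-layer l) ⟩
    Σℚ< (suc n) (λ l → indicator (near k l) * pairDrop H c l)
  ≡⟨ window (suc n) k (pairDrop H c) (s≤s (layer≤ n w)) ⟩
    prevLayer k (pairDrop H c) + pairDrop H c k + nextLayer (suc n) k (pairDrop H c) ∎
  where
  open ≡-Reasoning
  c k : ℕ
  c = toℕ w
  k = layer w
  F : ℕ → ℚ
  F b = indicator (near k (b ℕ./ 2)) * (H c - H b)
  -- w itself contributes nothing, so adjacency may be replaced by nearness of layers
  self-loop-free : ∀ x → indicator (G n w x) * (H c - H (toℕ x)) ≡ F (toℕ x)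
  self-loop-free x with w ≟ᶠ x
  ... | no  _    = refl
  ... | yes refl = trans (ℚₚ.*-zeroˡ (H c - H c))
                     (sym (trans (cong (indicator (near k k) *_) (ℚₚ.+-inverseʳ (H c))) (ℚₚ.*-zeroʳ (indicator (near k k)))))
  by-layer : ∀ l → F (l ℕ.* 2) + F (suc (l ℕ.* 2)) ≡ indicator (near k l) * pairDrop H c l
  by-layer l rewrite layer-even l | layer-odd l = sym (ℚₚ.*-distribˡ-+ (indicator (near k l)) _ _)

-- For a unit current from
-- vertex a (layer i) to vertex b (layer j ≥ i) we superpose
--   * a ramp, constant on layers, dropping by ¼ across each of the layer
--     boundaries i|i+1, …, j-1|j: it carries current ½ out of each
--     vertex of layer i and into each vertex of layer j;
--   * a dipole at a (+1 at a, -1 at its partner in layer i) weighted so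
--     that it carries current ½ out of a and into its partner, and the
--     negated dipole at b.
-- The net current is then +1 at a, -1 at b and 0 elsewhere.

¼ ½ ⅛ ⅟₁₂ : ℚ
¼   = ℤ.+ 1 / 4
½   = ℤ.+ 1 / 2
⅛   = ℤ.+ 1 / 8
⅟₁₂ = ℤ.+ 1 / 12

[_≟_] : ℕ → ℕ → ℚ
[ a ≟ b ] = indicator ⌊ a ℕ.≟ b ⌋

[≟]-yes : ∀ {a b} → a ≡ b → [ a ≟ b ] ≡ 1ℚ
[≟]-yes {a} {b} a≡b = cong indicator (⌊⌋-true (a ℕ.≟ b) a≡b)

[≟]-no : ∀ {a b} → ¬ a ≡ b → [ a ≟ b ] ≡ 0ℚ
[≟]-no {a} {b} a≢b = cong indicator (⌊⌋-false (a ℕ.≟ b) a≢b)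

rampStep : ℕ → ℕ → ℕ → ℚ
rampStep i j l = if ⌊ i ℕ.≤? l ⌋ ∧ ⌊ l ℕ.<? j ⌋ then ¼ else 0ℚ

ramp : ℕ → ℕ → ℕ → ℚ
ramp i j zero    = 0ℚ
ramp i j (suc l) = ramp i j l - rampStep i j l

rampStep-inside : ∀ {i j l} → i ≤ l → l < j → rampStep i j l ≡ ¼
rampStep-inside {i} {j} {l} i≤l l<j
  rewrite ⌊⌋-true (i ℕ.≤? l) i≤l | ⌊⌋-true (l ℕ.<? j) l<j = refl

rampStep-below : ∀ {i j l} → l < i → rampStep i j l ≡ 0ℚ
rampStep-below {i} {j} {l} l<i rewrite ⌊⌋-false (i ℕ.≤? l) (ℕₚ.<⇒≱ l<i) = refl

rampStep-above : ∀ {i j l} → j ≤ l → rampStep i j l ≡ 0ℚ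
rampStep-above {i} {j} {l} j≤l rewrite ⌊⌋-false (l ℕ.<? j) (ℕₚ.≤⇒≯ j≤l) =
  cong (λ b → if b then ¼ else 0ℚ) (∧-zeroʳ ⌊ i ℕ.≤? l ⌋)

prevStep-upto : ∀ {i j} k → k ≤ i → prevLayer k (rampStep i j) ≡ 0ℚ
prevStep-upto zero    _   = refl
prevStep-upto (suc k) k<i = rampStep-below k<i

prevStep-inside : ∀ {i j} k → i < k → k ≤ j → prevLayer k (rampStep i j) ≡ ¼
prevStep-inside (suc k) i<k k≤j = rampStep-inside (ℕ.s≤s⁻¹ i<k) k≤j

prevStep-above : ∀ {i j} k → j < k → prevLayer k (rampStep i j) ≡ 0ℚ
prevStep-above (suc k) j<k = rampStep-above (ℕ.s≤s⁻¹ j<k)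

ramp-flow : ∀ {i j} k → i ≤ j →
  rampStep i j k - prevLayer k (rampStep i j) ≡ ¼ * ([ k ≟ i ] - [ k ≟ j ])
ramp-flow {i} {j} k i≤j = by-cases (ℕ.<-cmp k i) (ℕ.<-cmp k j)
  where
  flow : ∀ {s p x y} → rampStep i j k ≡ s → prevLayer k (rampStep i j) ≡ p → [ k ≟ i ] ≡ x → [ k ≟ j ] ≡ y →
         s - p ≡ ¼ * (x - y) → rampStep i j k - prevLayer k (rampStep i j) ≡ ¼ * ([ k ≟ i ] - [ k ≟ j ])
  flow refl refl refl refl e = e
  by-cases : Tri (k < i) (k ≡ i) (i < k) → Tri (k < j) (k ≡ j) (j < k) →
             rampStep i j k - prevLayer k (rampStep i j) ≡ ¼ * ([ k ≟ i ] - [ k ≟ j ])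
  by-cases (tri< k<i _ _) _ =
    flow (rampStep-below k<i) (prevStep-upto k (ℕₚ.<⇒≤ k<i))
         ([≟]-no (ℕₚ.<⇒≢ k<i)) ([≟]-no (ℕₚ.<⇒≢ (ℕₚ.<-≤-trans k<i i≤j))) refl
  by-cases (tri≈ _ k≡i _) (tri< k<j _ _) =
    flow (rampStep-inside (ℕₚ.≤-reflexive (sym k≡i)) k<j) (prevStep-upto k (ℕₚ.≤-reflexive k≡i))
         ([≟]-yes k≡i) ([≟]-no (ℕₚ.<⇒≢ k<j)) refl
  by-cases (tri≈ _ k≡i _) (tri≈ _ k≡j _) =
    flow (rampStep-above (ℕₚ.≤-reflexive (sym k≡j))) (prevStep-upto k (ℕₚ.≤-reflexive k≡i))
         ([≟]-yes k≡i) ([≟]-yes k≡j) refl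
  by-cases (tri≈ _ k≡i _) (tri> _ _ j<k) = ⊥-elim (ℕₚ.<⇒≱ j<k (subst (_≤ j) (sym k≡i) i≤j))
  by-cases (tri> _ _ i<k) (tri< k<j _ _) =
    flow (rampStep-inside (ℕₚ.<⇒≤ i<k) k<j) (prevStep-inside k i<k (ℕₚ.<⇒≤ k<j))
         ([≟]-no (ℕₚ.>⇒≢ i<k)) ([≟]-no (ℕₚ.<⇒≢ k<j)) refl
  by-cases (tri> _ _ i<k) (tri≈ _ k≡j _) =
    flow (rampStep-above (ℕₚ.≤-reflexive (sym k≡j))) (prevStep-inside k i<k (ℕₚ.≤-reflexive k≡j))
         ([≟]-no (ℕₚ.>⇒≢ i<k)) ([≟]-yes k≡j) refl
  by-cases (tri> _ _ i<k) (tri> _ _ j<k) =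
    flow (rampStep-above (ℕₚ.<⇒≤ j<k)) (prevStep-above k j<k) ([≟]-no (ℕₚ.>⇒≢ i<k)) ([≟]-no (ℕₚ.>⇒≢ j<k)) refl

laplacian-superpose : ∀ {m} (g : Graph m) (φ ψ χ : Fin m → ℚ) w →
  laplacian g (λ x → φ x + ψ x - χ x) w ≡ laplacian g φ w + laplacian g ψ w - laplacian g χ w
laplacian-superpose g φ ψ χ w = begin
    Σℚ (λ x → e x * ((φ w + ψ w - χ w) - (φ x + ψ x - χ x)))
  ≡⟨ Σℚ-cong (λ x → solve 7 (λ e a a′ b b′ c c′ →
        e :* ((a :+ b :- c) :- (a′ :+ b′ :- c′)) := e :* (a :- a′) :+ e :* (b :- b′) :- e :* (c :- c′))
        refl (e x) (φ w) (φ x) (ψ w) (ψ x) (χ w) (χ x)) ⟩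
    Σℚ (λ x → Δ φ x + Δ ψ x - Δ χ x)
  ≡⟨ Σℚ-sub (λ x → Δ φ x + Δ ψ x) (Δ χ) ⟩
    Σℚ (λ x → Δ φ x + Δ ψ x) - Σℚ (Δ χ)
  ≡⟨ cong (_- Σℚ (Δ χ)) (Σℚ-distrib (Δ φ) (Δ ψ)) ⟩
    Σℚ (Δ φ) + Σℚ (Δ ψ) - Σℚ (Δ χ) ∎
  where
  open ≡-Reasoning
  e : _ → ℚ
  e x = indicator (g w x)
  Δ : (Fin _ → ℚ) → _ → ℚ
  Δ f x = e x * (f w - f x)

prevLayer-cong : ∀ k {Y Y′ : ℕ → ℚ} → (∀ l → Y l ≡ Y′ l) → prevLayer k Y ≡ prevLayer k Y′
prevLayer-cong zero    _    = refl
prevLayer-cong (suc k) Y≡Y′ = Y≡Y′ k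

nextLayer-cong : ∀ N k {Y Y′ : ℕ → ℚ} → (∀ l → Y l ≡ Y′ l) → nextLayer N k Y ≡ nextLayer N k Y′
nextLayer-cong N k Y≡Y′ = cong (λ y → if ⌊ suc k ℕ.<? N ⌋ then y else 0ℚ) (Y≡Y′ (suc k))

laplacian-ramp : ∀ n {i j} → i ≤ j → j ≤ n → (w : Fin (nV n)) →
  laplacian (G n) (λ x → ramp i j (layer x)) w ≡ ½ * ([ layer w ≟ i ] - [ layer w ≟ j ])
laplacian-ramp n {i} {j} i≤j j≤n w = begin
    laplacian (G n) (λ x → ramp i j (layer x)) w
  ≡⟨ laplacian-by-layers n H w ⟩
    prevLayer k Y + Y k + nextLayer (suc n) k Y
  ≡⟨ cong₂ _+_ (cong₂ _+_ prev-term current-term) next-term ⟩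
    - (p + p) + 0ℚ + (s + s)
  ≡⟨ solve 2 (λ p s → :- (p :+ p) :+ con 0ℚ :+ (s :+ s) := (s :- p) :+ (s :- p)) refl p s ⟩
    (s - p) + (s - p)
  ≡⟨ cong (λ z → z + z) (ramp-flow k i≤j) ⟩
    ¼ * X + ¼ * X
  ≡⟨ solve 1 (λ x → con ¼ :* x :+ con ¼ :* x := con ½ :* x) refl X ⟩
    ½ * X ∎
  where
  open ≡-Reasoning
  R : ℕ → ℚ
  R = ramp i j
  H : ℕ → ℚ
  H c = R (c ℕ./ 2)
  k : ℕ
  k = layer w
  Y : ℕ → ℚ
  Y = pairDrop H (toℕ w)
  s p X : ℚ
  s = rampStep i j k
  p = prevLayer k (rampStep i j)
  X = [ k ≟ i ] - [ k ≟ j ]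
  Y≡ : ∀ l → Y l ≡ (R k - R l) + (R k - R l)
  Y≡ l rewrite layer-even l | layer-odd l = refl
  drops : ∀ m → prevLayer m (λ l → (R m - R l) + (R m - R l))
                 ≡ - (prevLayer m (rampStep i j) + prevLayer m (rampStep i j))
  drops zero    = refl
  drops (suc l) = solve 2 (λ r t → (r :- t :- r) :+ (r :- t :- r) := :- (t :+ t)) refl (R l) (rampStep i j l)
  prev-term : prevLayer k Y ≡ - (p + p)
  prev-term = trans (prevLayer-cong k Y≡) (drops k)
  current-term : Y k ≡ 0ℚ
  current-term = trans (Y≡ k) (solve 1 (λ r → (r :- r) :+ (r :- r) := con 0ℚ) refl (R k))
  next-term : nextLayer (suc n) k Y ≡ s + s
  next-term with suc k ℕ.<? suc n
  ... | yes _   = trans (Y≡ (suc k)) (solve 2 (λ r t → (r :- (r :- t)) :+ (r :- (r :- t)) := t :+ t) refl (R k) s)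
  ... | no  k≮n = sym (trans (cong (λ z → z + z) (rampStep-above {i} (ℕₚ.≤-trans j≤n (ℕₚ.≮⇒≥ (k≮n ∘ s≤s)))))
                             (ℚₚ.+-identityʳ 0ℚ))

-- The dipole at vertex a: +1 at a, -1 at the other vertex of a's layer.
dipole : ℕ → ℕ → ℚ
dipole a c = ([ c ≟ a ] + [ c ≟ a ]) - [ c ℕ./ 2 ≟ a ℕ./ 2 ]

even-or-odd : ∀ a → a ≡ (a ℕ./ 2) ℕ.* 2 ⊎ a ≡ suc ((a ℕ./ 2) ℕ.* 2)
even-or-odd a with a ℕ.% 2 | ℕ÷.m%n<n a 2 | ℕ÷.m≡m%n+[m/n]*n a 2
... | zero        | _               | a≡ = inj₁ a≡
... | suc zero    | _               | a≡ = inj₂ a≡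
... | suc (suc _) | s≤s (s≤s ())    | _

layer-hit : ∀ a l → [ l ℕ.* 2 ≟ a ] + [ suc (l ℕ.* 2) ≟ a ] ≡ [ l ≟ a ℕ./ 2 ]
layer-hit a l with l ℕ.≟ a ℕ./ 2
... | no l≢h = cong₂ _+_ ([≟]-no {l ℕ.* 2} {a} (λ e → l≢h (trans (sym (layer-even l)) (cong (ℕ._/ 2) e))))
                         ([≟]-no {suc (l ℕ.* 2)} {a} (λ e → l≢h (trans (sym (layer-odd l)) (cong (ℕ._/ 2) e))))
... | yes refl with even-or-odd a
...   | inj₁ a≡ = cong₂ _+_ ([≟]-yes (sym a≡)) ([≟]-no (λ e → ℕₚ.1+n≢n (trans e a≡)))
...   | inj₂ a≡ = cong₂ _+_ ([≟]-no (λ e → ℕₚ.1+n≢n (sym (trans e a≡)))) ([≟]-yes (sym a≡))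

dipole-layer-sum : ∀ a l → dipole a (l ℕ.* 2) + dipole a (suc (l ℕ.* 2)) ≡ 0ℚ
dipole-layer-sum a l rewrite layer-even l | layer-odd l = begin
    (x + x - z) + (y + y - z)   ≡⟨ solve 3 (λ x y z → (x :+ x :- z) :+ (y :+ y :- z) := (x :+ y :- z) :+ (x :+ y :- z))
                                     refl x y z ⟩
    (x + y - z) + (x + y - z)   ≡⟨ cong (λ t → (t - z) + (t - z)) (layer-hit a l) ⟩
    (z - z) + (z - z)           ≡⟨ solve 1 (λ z → (z :- z) :+ (z :- z) := con 0ℚ) refl z ⟩
    0ℚ                          ∎
  where
  open ≡-Reasoning
  x = [ l ℕ.* 2 ≟ a ]
  y = [ suc (l ℕ.* 2) ≟ a ]
  z = [ l ≟ a ℕ./ 2 ]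

dipole-elsewhere : ∀ a c → ¬ c ℕ./ 2 ≡ a ℕ./ 2 → dipole a c ≡ 0ℚ
dipole-elsewhere a c other-layer
  rewrite [≟]-no {c} {a} (other-layer ∘ cong (ℕ._/ 2)) | [≟]-no other-layer = refl

neighbourLayers : ℕ → ℕ → ℚ
neighbourLayers n k = prevLayer k (λ _ → 1ℚ) + 1ℚ + nextLayer (suc n) k (λ _ → 1ℚ)

-- The dipole weight: ⅛ on the two end layers (2 neighbouring layers),
-- 1/12 on inner layers (3 neighbouring layers).
dipoleWeight : ℕ → ℕ → ℚ
dipoleWeight n i = if ⌊ i ℕ.≟ 0 ⌋ ∨ ⌊ i ℕ.≟ n ⌋ then ⅛ else ⅟₁₂

-- The weighted dipole balances: twice its weight times the number of
-- neighbouring layers is ½ (this is where n ≥ 1 is needed).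
dipoleWeight-balance : ∀ n i → 1 ≤ n → i ≤ n → (dipoleWeight n i + dipoleWeight n i) * neighbourLayers n i ≡ ½
dipoleWeight-balance (suc n) zero    _ _ = refl
dipoleWeight-balance n       (suc i) _ i≤n with suc i ℕ.≟ n
... | yes refl rewrite ⌊⌋-false (suc (suc i) ℕ.<? suc (suc i)) (ℕₚ.<-irrefl refl) = refl
... | no  i≢n  rewrite ⌊⌋-true (suc (suc i) ℕ.<? suc n) (s≤s (ℕₚ.≤∧≢⇒< i≤n i≢n)) = refl

prevLayer-const : ∀ k x → prevLayer k (λ _ → x) ≡ x * prevLayer k (λ _ → 1ℚ)
prevLayer-const zero    x = sym (ℚₚ.*-zeroʳ x)
prevLayer-const (suc k) x = sym (ℚₚ.*-identityʳ x)

nextLayer-const : ∀ N k x → nextLayer N k (λ _ → x) ≡ x * nextLayer N k (λ _ → 1ℚ)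
nextLayer-const N k x with ⌊ suc k ℕ.<? N ⌋
... | true  = sym (ℚₚ.*-identityʳ x)
... | false = sym (ℚₚ.*-zeroʳ x)

laplacian-dipole : ∀ n a → 1 ≤ n → a ℕ./ 2 ≤ n → (w : Fin (nV n)) →
  laplacian (G n) (λ x → dipoleWeight n (a ℕ./ 2) * dipole a (toℕ x)) w ≡ ½ * dipole a (toℕ w)
laplacian-dipole n a 1≤n a≤n w = begin
    laplacian (G n) (H ∘ toℕ) w
  ≡⟨ laplacian-by-layers n H w ⟩
    prevLayer k (pairDrop H c) + pairDrop H c k + nextLayer (suc n) k (pairDrop H c)
  ≡⟨ cong₂ _+_ (cong₂ _+_ (prevLayer-cong k Y≡) (Y≡ k)) (nextLayer-cong (suc n) k Y≡) ⟩
    prevLayer k (λ _ → d + d) + (d + d) + nextLayer (suc n) k (λ _ → d + d)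
  ≡⟨ cong₂ _+_ (cong (_+ (d + d)) (prevLayer-const k (d + d))) (nextLayer-const (suc n) k (d + d)) ⟩
    (d + d) * prevLayer k (λ _ → 1ℚ) + (d + d) + (d + d) * nextLayer (suc n) k (λ _ → 1ℚ)
  ≡⟨ solve 3 (λ x p q → x :* p :+ x :+ x :* q := x :* (p :+ con 1ℚ :+ q)) refl (d + d) _ _ ⟩
    (d + d) * neighbourLayers n k
  ≡⟨ balance (k ℕ.≟ a ℕ./ 2) ⟩
    ½ * dipole a c ∎
  where
  open ≡-Reasoning
  ω : ℚ
  ω = dipoleWeight n (a ℕ./ 2)
  H : ℕ → ℚ
  H c = ω * dipole a c
  c k : ℕ
  c = toℕ w
  k = layer w
  d : ℚ
  d = H c
  Y≡ : ∀ l → pairDrop H c l ≡ d + d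
  Y≡ l = begin
      (d - ω * dipole a (l ℕ.* 2)) + (d - ω * dipole a (suc (l ℕ.* 2)))
    ≡⟨ solve 4 (λ d ω x y → (d :- ω :* x) :+ (d :- ω :* y) := (d :+ d) :- ω :* (x :+ y))
         refl d ω (dipole a (l ℕ.* 2)) (dipole a (suc (l ℕ.* 2))) ⟩
      (d + d) - ω * (dipole a (l ℕ.* 2) + dipole a (suc (l ℕ.* 2)))
    ≡⟨ cong (λ t → (d + d) - ω * t) (dipole-layer-sum a l) ⟩
      (d + d) - ω * 0ℚ
    ≡⟨ solve 2 (λ d ω → (d :+ d) :- ω :* con 0ℚ := d :+ d) refl d ω ⟩
      d + d ∎
  balance : Dec (k ≡ a ℕ./ 2) → (d + d) * neighbourLayers n k ≡ ½ * dipole a c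
  balance (yes k≡) = begin
      (ω * dipole a c + ω * dipole a c) * neighbourLayers n k
    ≡⟨ solve 3 (λ ω x q → (ω :* x :+ ω :* x) :* q := ((ω :+ ω) :* q) :* x) refl ω (dipole a c) _ ⟩
      ((ω + ω) * neighbourLayers n k) * dipole a c
    ≡⟨ cong (λ l → ((ω + ω) * neighbourLayers n l) * dipole a c) k≡ ⟩
      ((ω + ω) * neighbourLayers n (a ℕ./ 2)) * dipole a c
    ≡⟨ cong (_* dipole a c) (dipoleWeight-balance n (a ℕ./ 2) 1≤n a≤n) ⟩
      ½ * dipole a c ∎
  balance (no k≢) rewrite dipole-elsewhere a c k≢ =
    trans (cong (_* neighbourLayers n k) (solve 1 (λ ω → ω :* con 0ℚ :+ ω :* con 0ℚ := con 0ℚ) refl ω))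
          (trans (ℚₚ.*-zeroˡ (neighbourLayers n k)) (sym (ℚₚ.*-zeroʳ ½)))

flowPotential : ℕ → ℕ → ℕ → ℕ → ℚ
flowPotential n a b c =
  ramp (a ℕ./ 2) (b ℕ./ 2) (c ℕ./ 2) + dipoleWeight n (a ℕ./ 2) * dipole a c - dipoleWeight n (b ℕ./ 2) * dipole b c

[≟]-toℕ : ∀ {m} (w u : Fin m) → [ toℕ w ≟ toℕ u ] ≡ indicator ⌊ w ≟ᶠ u ⌋
[≟]-toℕ w u with w ≟ᶠ u
... | yes refl = [≟]-yes {toℕ w} refl
... | no  w≢u  = [≟]-no (w≢u ∘ Finₚ.toℕ-injective)

flowPotential-unit-current : ∀ n (u v : Fin (nV n)) → 1 ≤ n → toℕ u < toℕ v →
  IsUnitCurrentPotential (G n) u v (flowPotential n (toℕ u) (toℕ v) ∘ toℕ)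
flowPotential-unit-current n u v 1≤n u<v w = begin
    sumℚ (map (λ x → indicator (G n w x) * (H (toℕ w) - H (toℕ x))) (allFin (nV n)))
  ≡⟨ sumℚ-allFin (λ x → indicator (G n w x) * (H (toℕ w) - H (toℕ x))) ⟩
    laplacian (G n) (H ∘ toℕ) w
  ≡⟨ laplacian-superpose (G n) (λ x → ramp i j (layer x)) (λ x → ωᵢ * dipole a (toℕ x))
                                 (λ x → ωⱼ * dipole b (toℕ x)) w ⟩
    laplacian (G n) (λ x → ramp i j (layer x)) w + laplacian (G n) (λ x → ωᵢ * dipole a (toℕ x)) w
      - laplacian (G n) (λ x → ωⱼ * dipole b (toℕ x)) w
  ≡⟨ cong₂ _-_ (cong₂ _+_ (laplacian-ramp n i≤j (layer≤ n v) w) (laplacian-dipole n a 1≤n (layer≤ n u) w))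
                (laplacian-dipole n b 1≤n (layer≤ n v) w) ⟩
    ½ * ([ k ≟ i ] - [ k ≟ j ]) + ½ * dipole a c - ½ * dipole b c
  ≡⟨ solve 4 (λ x y p q → con ½ :* (x :- y) :+ con ½ :* ((p :+ p) :- x) :- con ½ :* ((q :+ q) :- y) := p :- q)
       refl [ k ≟ i ] [ k ≟ j ] [ c ≟ a ] [ c ≟ b ] ⟩
    [ c ≟ a ] - [ c ≟ b ]
  ≡⟨ cong₂ _-_ ([≟]-toℕ w u) ([≟]-toℕ w v) ⟩
    indicator ⌊ w ≟ᶠ u ⌋ - indicator ⌊ w ≟ᶠ v ⌋ ∎
  where
  open ≡-Reasoning
  a b c i j k : ℕ
  a = toℕ u
  b = toℕ v
  c = toℕ w
  i = layer u
  j = layer v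
  k = layer w
  ωᵢ ωⱼ : ℚ
  ωᵢ = dipoleWeight n i
  ωⱼ = dipoleWeight n j
  H : ℕ → ℚ
  H = flowPotential n a b
  i≤j : i ≤ j
  i≤j = ℕ÷./-monoˡ-≤ 2 (ℕₚ.<⇒≤ u<v)

G-symmetric : ∀ n (x y : Fin (nV n)) → G n x y ≡ G n y x
G-symmetric n x y = cong₂ (λ p q → not p ∧ q) ≟-sym (∧-comm ⌊ (layer x ∸ layer y) ℕ.≤? 1 ⌋ _)
  where
  ≟-sym : ⌊ x ≟ᶠ y ⌋ ≡ ⌊ y ≟ᶠ x ⌋
  ≟-sym with x ≟ᶠ y
  ... | yes x≡y = sym (⌊⌋-true (y ≟ᶠ x) (sym x≡y))
  ... | no  x≢y = sym (⌊⌋-false (y ≟ᶠ x) (x≢y ∘ sym))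

resistance-G : ∀ n (u v : Fin (nV n)) r → IsEffectiveResistance (G n) u v r → 1 ≤ n → toℕ u < toℕ v →
  r ≡ flowPotential n (toℕ u) (toℕ v) (toℕ u) - flowPotential n (toℕ u) (toℕ v) (toℕ v)
resistance-G n u v r (φ , φ-unit , r≡φu-φv) 1≤n u<v =
  trans r≡φu-φv (potential-difference-unique (G n) (G-symmetric n) u v φ (flowPotential n (toℕ u) (toℕ v) ∘ toℕ) φ-unit
                   (flowPotential-unit-current n u v 1≤n u<v))

qN : ℕ → ℚ
qN n = ℤ.+ n / 1

qN-mkℚ : ∀ n → qN n ≡ mkℚ (ℤ.+ n) 0 (Coprime-sym (1-coprimeTo n))
qN-mkℚ n = ℚₚ.normalize-coprime (Coprime-sym (1-coprimeTo n))

qN-+ : ∀ a b → qN (a ℕ.+ b) ≡ qN a + qN b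
qN-+ a b rewrite qN-mkℚ a | qN-mkℚ b | qN-mkℚ (a ℕ.+ b) =
  ℚₚ.toℚᵘ-injective (ℚᵘₚ.≃-trans (ℚᵘ.*≡* num≡) (ℚᵘₚ.≃-sym (ℚₚ.toℚᵘ-homo-+ (mkℚ (ℤ.+ a) 0 (Coprime-sym (1-coprimeTo a))) (mkℚ (ℤ.+ b) 0 (Coprime-sym (1-coprimeTo b))))))
  where
  num≡ : ℤ.+ (a ℕ.+ b) ℤ.* ℤ.+ 1 ≡ (ℤ.+ a ℤ.* ℤ.+ 1 ℤ.+ ℤ.+ b ℤ.* ℤ.+ 1) ℤ.* ℤ.+ 1
  num≡ = trans (ℤₚ.*-identityʳ _) (trans (ℤₚ.pos-+ a b)
           (sym (trans (ℤₚ.*-identityʳ _) (cong₂ ℤ._+_ (ℤₚ.*-identityʳ (ℤ.+ a)) (ℤₚ.*-identityʳ (ℤ.+ b))))))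

qN-* : ∀ a b → qN (a ℕ.* b) ≡ qN a * qN b
qN-* a b rewrite qN-mkℚ a | qN-mkℚ b | qN-mkℚ (a ℕ.* b) =
  ℚₚ.toℚᵘ-injective (ℚᵘₚ.≃-trans (ℚᵘ.*≡* (cong (ℤ._* ℤ.+ 1) (ℤₚ.pos-* a b)))
                                 (ℚᵘₚ.≃-sym (ℚₚ.toℚᵘ-homo-* (mkℚ (ℤ.+ a) 0 (Coprime-sym (1-coprimeTo a))) (mkℚ (ℤ.+ b) 0 (Coprime-sym (1-coprimeTo b))))))

qN-nonneg : ∀ a → 0ℚ ℚ.≤ qN a
qN-nonneg a rewrite qN-mkℚ a = ℚₚ.nonNegative⁻¹ (mkℚ (ℤ.+ a) 0 (Coprime-sym (1-coprimeTo a)))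

qN-mono : ∀ {a b} → a ≤ b → qN a ℚ.≤ qN b
qN-mono {a} {b} a≤b = begin
    qN a               ≡⟨ sym (ℚₚ.+-identityʳ (qN a)) ⟩
    qN a + 0ℚ          ≤⟨ ℚₚ.+-monoʳ-≤ (qN a) (qN-nonneg (b ∸ a)) ⟩
    qN a + qN (b ∸ a)  ≡⟨ sym (qN-+ a (b ∸ a)) ⟩
    qN (a ℕ.+ (b ∸ a)) ≡⟨ cong qN (ℕₚ.m+[n∸m]≡n a≤b) ⟩
    qN b               ∎
  where open ℚₚ.≤-Reasoning

inverse-mkℚ : ∀ k → ℤ.+ 1 / suc k ≡ mkℚ (ℤ.+ 1) k (1-coprimeTo (suc k))
inverse-mkℚ k = ℚₚ.normalize-coprime (1-coprimeTo (suc k))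

qN-inverse : ∀ k → qN (suc k) * (ℤ.+ 1 / suc k) ≡ 1ℚ
qN-inverse k rewrite qN-mkℚ (suc k) | inverse-mkℚ k = ℚₚ.*-inverseʳ (mkℚ (ℤ.+ suc k) 0 (Coprime-sym (1-coprimeTo (suc k))))

inverse-nonneg : ∀ k → 0ℚ ℚ.≤ ℤ.+ 1 / suc k
inverse-nonneg k rewrite inverse-mkℚ k = ℚₚ.nonNegative⁻¹ (mkℚ (ℤ.+ 1) k (1-coprimeTo (suc k)))

ramp-drop : ∀ i j d → i ℕ.+ d ≤ j → ramp i j i - ramp i j (i ℕ.+ d) ≡ ¼ * qN d
ramp-drop i j zero    _     = trans (cong (λ l → ramp i j i - ramp i j l) (ℕₚ.+-identityʳ i))
                                    (ℚₚ.+-inverseʳ (ramp i j i))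
ramp-drop i j (suc d) i+d<j = begin
    ramp i j i - ramp i j (i ℕ.+ suc d)
  ≡⟨ cong (λ l → ramp i j i - ramp i j l) (ℕₚ.+-suc i d) ⟩
    ramp i j i - (ramp i j (i ℕ.+ d) - rampStep i j (i ℕ.+ d))
  ≡⟨ cong (λ s → ramp i j i - (ramp i j (i ℕ.+ d) - s)) (rampStep-inside (ℕₚ.m≤m+n i d) i+d<j′) ⟩
    ramp i j i - (ramp i j (i ℕ.+ d) - ¼)
  ≡⟨ solve 2 (λ x y → x :- (y :- con ¼) := (x :- y) :+ con ¼) refl (ramp i j i) (ramp i j (i ℕ.+ d)) ⟩
    (ramp i j i - ramp i j (i ℕ.+ d)) + ¼
  ≡⟨ cong (_+ ¼) (ramp-drop i j d (ℕₚ.<⇒≤ i+d<j′)) ⟩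
    ¼ * qN d + ¼
  ≡⟨ solve 1 (λ q → con ¼ :* q :+ con ¼ := con ¼ :* (con 1ℚ :+ q)) refl (qN d) ⟩
    ¼ * (1ℚ + qN d)
  ≡⟨ cong (¼ *_) (sym (qN-+ 1 d)) ⟩
    ¼ * qN (suc d) ∎
  where
  open ≡-Reasoning
  i+d<j′ : i ℕ.+ d < j
  i+d<j′ = subst (_≤ j) (ℕₚ.+-suc i d) i+d<j

Bounded : ℚ → Set
Bounded e = 0ℚ ℚ.≤ e × e ℚ.≤ ¼

bounded-by-evaluation : ∀ e → {True (0ℚ ℚₚ.≤? e)} → {True (e ℚₚ.≤? ¼)} → Bounded e
bounded-by-evaluation e {0≤e} {e≤¼} = toWitness 0≤e , toWitness e≤¼

dipoleWeight-values : ∀ n i → dipoleWeight n i ≡ ⅛ ⊎ dipoleWeight n i ≡ ⅟₁₂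
dipoleWeight-values n i with ⌊ i ℕ.≟ 0 ⌋ ∨ ⌊ i ℕ.≟ n ⌋
... | true  = inj₁ refl
... | false = inj₂ refl

[≟]-sym : ∀ a b → [ a ≟ b ] ≡ [ b ≟ a ]
[≟]-sym a b with a ℕ.≟ b
... | yes a≡b = sym ([≟]-yes (sym a≡b))
... | no  a≢b = sym ([≟]-no (a≢b ∘ sym))

dipole-at-source : ∀ a → dipole a a ≡ 1ℚ
dipole-at-source a rewrite [≟]-yes {a} refl | [≟]-yes {a ℕ./ 2} refl = refl

dipole-away : ∀ {a c} → ¬ c ≡ a → dipole a c ≡ - [ c ℕ./ 2 ≟ a ℕ./ 2 ]
dipole-away {a} {c} c≢a rewrite [≟]-no c≢a = ℚₚ.+-identityˡ _

flowPotential-drop : ∀ n a b → ¬ a ≡ b →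
  flowPotential n a b a - flowPotential n a b b
    ≡ (ramp (a ℕ./ 2) (b ℕ./ 2) (a ℕ./ 2) - ramp (a ℕ./ 2) (b ℕ./ 2) (b ℕ./ 2))
      + (dipoleWeight n (a ℕ./ 2) + dipoleWeight n (b ℕ./ 2)) * (1ℚ + [ a ℕ./ 2 ≟ b ℕ./ 2 ])
flowPotential-drop n a b a≢b
  rewrite dipole-at-source a | dipole-at-source b | dipole-away {b} {a} a≢b | dipole-away {a} {b} (a≢b ∘ sym)
        | [≟]-sym (b ℕ./ 2) (a ℕ./ 2) =
  solve 5 (λ r s ω ω′ x → (r :+ ω :* con 1ℚ :- ω′ :* (:- x)) :- (s :+ ω :* (:- x) :- ω′ :* con 1ℚ)
                          := (r :- s) :+ (ω :+ ω′) :* (con 1ℚ :+ x))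
    refl (ramp i j i) (ramp i j j) (dipoleWeight n i) (dipoleWeight n j) [ i ≟ j ]
  where
  i j : ℕ
  i = a ℕ./ 2
  j = b ℕ./ 2

-- For i < j the excess is ωᵢ + ωⱼ ∈ [1/6, ¼]; for i = j it is 4ω - ¼ ∈ {1/12, ¼}.
excess-bounded : ∀ n i j → i ≤ j →
  Bounded ((ramp i j i - ramp i j j) + (dipoleWeight n i + dipoleWeight n j) * (1ℚ + [ i ≟ j ])
           - ¼ * qN (layerDist i j))
excess-bounded n i j i≤j with ℕₚ.m≤n⇒m<n∨m≡n i≤j
... | inj₁ i<j = subst Bounded (sym excess≡) (weights (dipoleWeight-values n i) (dipoleWeight-values n j))
  where
  d : ℕ
  d = j ∸ i
  excess≡ : (ramp i j i - ramp i j j) + (dipoleWeight n i + dipoleWeight n j) * (1ℚ + [ i ≟ j ])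
            - ¼ * qN (layerDist i j) ≡ dipoleWeight n i + dipoleWeight n j
  excess≡ rewrite [≟]-no (ℕₚ.<⇒≢ i<j) | layerDist-below i j i<j
                | sym (cong (λ l → ramp i j i - ramp i j l) (ℕₚ.m+[n∸m]≡n i≤j))
                | ramp-drop i j d (ℕₚ.≤-reflexive (ℕₚ.m+[n∸m]≡n i≤j)) =
    solve 3 (λ q ω ω′ → con ¼ :* q :+ (ω :+ ω′) :* (con 1ℚ :+ con 0ℚ) :- con ¼ :* q := ω :+ ω′)
      refl (qN d) (dipoleWeight n i) (dipoleWeight n j)
  weights : ∀ {x y} → x ≡ ⅛ ⊎ x ≡ ⅟₁₂ → y ≡ ⅛ ⊎ y ≡ ⅟₁₂ → Bounded (x + y)
  weights (inj₁ refl) (inj₁ refl) = bounded-by-evaluation _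
  weights (inj₁ refl) (inj₂ refl) = bounded-by-evaluation _
  weights (inj₂ refl) (inj₁ refl) = bounded-by-evaluation _
  weights (inj₂ refl) (inj₂ refl) = bounded-by-evaluation _
... | inj₂ refl = subst Bounded (sym excess≡) (weight (dipoleWeight-values n i))
  where
  excess≡ : (ramp i i i - ramp i i i) + (dipoleWeight n i + dipoleWeight n i) * (1ℚ + [ i ≟ i ])
            - ¼ * qN (layerDist i i) ≡ (dipoleWeight n i + dipoleWeight n i) * (1ℚ + 1ℚ) - ¼
  excess≡ rewrite [≟]-yes {i} refl | ℕₚ.∣n-n∣≡0 i =
    solve 2 (λ r ω → (r :- r) :+ ω :* (con 1ℚ :+ con 1ℚ) :- con ¼ :* con 1ℚ := ω :* (con 1ℚ :+ con 1ℚ) :- con ¼)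
      refl (ramp i i i) (dipoleWeight n i + dipoleWeight n i)
  weight : ∀ {x} → x ≡ ⅛ ⊎ x ≡ ⅟₁₂ → Bounded ((x + x) * (1ℚ + 1ℚ) - ¼)
  weight (inj₁ refl) = bounded-by-evaluation _
  weight (inj₂ refl) = bounded-by-evaluation _

pairs-ordered : ∀ m → All (λ p → toℕ (proj₁ p) < toℕ (proj₂ p)) (pairs m)
pairs-ordered m = outer (allFin m)
  where
  Ordered : Fin m × Fin m → Set
  Ordered p = toℕ (proj₁ p) < toℕ (proj₂ p)
  inner : ∀ u L acc → All Ordered acc →
    All Ordered (foldr (λ v acc′ → if ⌊ toℕ u ℕ.<? toℕ v ⌋ then (u , v) ∷ acc′ else acc′) acc L)
  inner u []      acc ok = ok
  inner u (v ∷ L) acc ok with toℕ u ℕ.<? toℕ v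
  ... | yes u<v = u<v ∷ inner u L acc ok
  ... | no  _   = inner u L acc ok
  outer : ∀ L → All Ordered (foldr (λ u acc → foldr (λ v acc′ →
            if ⌊ toℕ u ℕ.<? toℕ v ⌋ then (u , v) ∷ acc′ else acc′) acc (allFin m)) [] L)
  outer []      = []
  outer (u ∷ L) = inner u (allFin m) _ (outer L)

sum-split : ∀ {X : Set} (f : X → ℚ) (d : X → ℕ) L →
  sumℚ (map f L) ≡ ¼ * qN (sumℕ (map d L)) + sumℚ (map (λ p → f p - ¼ * qN (d p)) L)
sum-split f d []      = refl
sum-split f d (x ∷ L) = begin
    f x + sumℚ (map f L)
  ≡⟨ cong (f x +_) (sum-split f d L) ⟩
    f x + (¼ * qN (sumℕ (map d L)) + E)
  ≡⟨ solve 4 (λ a q Q e → a :+ (con ¼ :* Q :+ e) := con ¼ :* (q :+ Q) :+ ((a :- con ¼ :* q) :+ e))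
       refl (f x) (qN (d x)) (qN (sumℕ (map d L))) E ⟩
    ¼ * (qN (d x) + qN (sumℕ (map d L))) + ((f x - ¼ * qN (d x)) + E)
  ≡⟨ cong (λ q → ¼ * q + ((f x - ¼ * qN (d x)) + E)) (sym (qN-+ (d x) (sumℕ (map d L)))) ⟩
    ¼ * qN (d x ℕ.+ sumℕ (map d L)) + ((f x - ¼ * qN (d x)) + E) ∎
  where
  open ≡-Reasoning
  E : ℚ
  E = sumℚ (map (λ p → f p - ¼ * qN (d p)) L)

sum-bounded : ∀ {X : Set} {P : X → Set} (g : X → ℚ) L → All P L → (∀ p → P p → Bounded (g p)) →
  0ℚ ℚ.≤ sumℚ (map g L) × sumℚ (map g L) ℚ.≤ ¼ * qN (sumℕ (map (λ _ → 1) L))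
sum-bounded g []      []         _       = ℚₚ.≤-refl , toWitness {a? = 0ℚ ℚₚ.≤? ¼ * qN 0} _
sum-bounded g (x ∷ L) (px ∷ pL) bounded with bounded x px | sum-bounded g L pL bounded
... | 0≤gx , gx≤¼ | 0≤Σ , Σ≤ = ℚₚ.+-mono-≤ 0≤gx 0≤Σ ,
  ℚₚ.≤-trans (ℚₚ.+-mono-≤ gx≤¼ Σ≤) (ℚₚ.≤-reflexive (begin
      ¼ + ¼ * qN c                ≡⟨ solve 1 (λ q → con ¼ :+ con ¼ :* q := con ¼ :* (con 1ℚ :+ q)) refl (qN c) ⟩
      ¼ * (1ℚ + qN c)             ≡⟨ cong (¼ *_) (sym (qN-+ 1 c)) ⟩
      ¼ * qN (suc c)              ∎))
  where
  open ≡-Reasoning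
  c = sumℕ (map (λ _ → 1) L)

pairCount : ℕ → ℕ
pairCount n = sumℕ (map (λ _ → 1) (pairs (nV n)))

kirchhoff-excess : ∀ n (R : Fin (nV n) → Fin (nV n) → ℚ) → (∀ u v → IsEffectiveResistance (G n) u v (R u v)) →
  1 ≤ n → ∃ λ E → kirchhoff R ≡ ¼ * qN (wiener (G n)) + E × 0ℚ ℚ.≤ E × E ℚ.≤ ¼ * qN (pairCount n)
kirchhoff-excess n R R-eff 1≤n =
  _ , sum-split resistance distance (pairs (nV n)) , sum-bounded excess (pairs (nV n)) (pairs-ordered (nV n)) bounded
  where
  resistance : Fin (nV n) × Fin (nV n) → ℚ
  resistance p = R (proj₁ p) (proj₂ p)
  distance : Fin (nV n) × Fin (nV n) → ℕ
  distance p = dist (G n) (proj₁ p) (proj₂ p)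
  excess : Fin (nV n) × Fin (nV n) → ℚ
  excess p = resistance p - ¼ * qN (distance p)
  bounded : ∀ p → toℕ (proj₁ p) < toℕ (proj₂ p) → Bounded (excess p)
  bounded (u , v) u<v = subst Bounded (sym (cong₂ (λ ρ δ → ρ - ¼ * qN δ)
      (trans (resistance-G n u v (R u v) (R-eff u v) 1≤n u<v) (flowPotential-drop n (toℕ u) (toℕ v) (ℕₚ.<⇒≢ u<v)))
      (dist-G n (λ u≡v → ℕₚ.<⇒≢ u<v (cong toℕ u≡v)))))
    (excess-bounded n (layer u) (layer v) (ℕ÷./-monoˡ-≤ 2 (ℕₚ.<⇒≤ u<v)))

wiener-vs-pairs : ∀ n → 3 ℕ.* wiener (G n) ≡ n ℕ.* pairCount n ℕ.+ 3 ℕ.* (suc n ℕ.* suc n)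
wiener-vs-pairs n = begin
    3 ℕ.* wiener (G n)                                       ≡⟨ wiener-closed n ⟩
    suc n ℕ.* (2 ℕ.* (suc n ℕ.* suc n) ℕ.+ 1)                ≡⟨ arith n ⟩
    n ℕ.* (suc n ℕ.* suc (2 ℕ.* n)) ℕ.+ 3 ℕ.* (suc n ℕ.* suc n) ≡⟨ cong (λ c → n ℕ.* c ℕ.+ 3 ℕ.* (suc n ℕ.* suc n)) (sym (pair-count n)) ⟩
    n ℕ.* pairCount n ℕ.+ 3 ℕ.* (suc n ℕ.* suc n)            ∎
  where
  open ≡-Reasoning
  arith : ∀ n → suc n ℕ.* (2 ℕ.* (suc n ℕ.* suc n) ℕ.+ 1) ≡ n ℕ.* (suc n ℕ.* suc (2 ℕ.* n)) ℕ.+ 3 ℕ.* (suc n ℕ.* suc n)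
  arith = solve-∀

wiener-positive : ∀ n → 1 ≤ wiener (G n)
wiener-positive n = ℕₚ.*-cancelˡ-≤ 3 (ℕₚ.≤-trans (ℕₚ.*-monoʳ-≤ 3 (s≤s (z≤n {n ℕ.+ n ℕ.* suc n})))
                      (ℕₚ.≤-trans (ℕₚ.m≤n+m _ (n ℕ.* pairCount n)) (ℕₚ.≤-reflexive (sym (wiener-vs-pairs n)))))

-- If K = ¼W + E with 0 ≤ E ≤ ¼C and nC ≤ 3W, then |K/W - ¼| = E/W ≤ 3/(4n) < 1/n.
ratio-close : ∀ (K ε : ℚ) (W C n d : ℕ) → (∃ λ E → K ≡ ¼ * qN W + E × 0ℚ ℚ.≤ E × E ℚ.≤ ¼ * qN C) →
  n ℕ.* C ≤ 3 ℕ.* W → 1 ≤ W → suc d ≤ n → mkℚ (ℤ.+ 1) d (1-coprimeTo (suc d)) ℚ.≤ ε → 0ℚ ℚ.< ε →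
  ℚ.∣ divℕ K W - ¼ ∣ ℚ.< ε
ratio-close K ε (suc w) C n d (E , K≡ , 0≤E , E≤¼C) nC≤3W _ d<n 1/[d+1]≤ε 0<ε = begin-strict
    ℚ.∣ K * y - ¼ ∣      ≡⟨ cong ℚ.∣_∣ deviation ⟩
    ℚ.∣ E * y ∣          ≡⟨ ℚₚ.0≤p⇒∣p∣≡p 0≤Ey ⟩
    E * y                <⟨ ℚₚ.*-cancelʳ-<-nonNeg (qN n) scaled ⟩
    ε                    ∎
  where
  open ℚₚ.≤-Reasoning
  y : ℚ
  y = ℤ.+ 1 / suc w
  instance
    y-nonneg : ℚ.NonNegative y
    y-nonneg = ℚ.nonNegative (inverse-nonneg w)
    n-nonneg : ℚ.NonNegative (qN n)
    n-nonneg = ℚ.nonNegative (qN-nonneg n)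
    ε-nonneg : ℚ.NonNegative ε
    ε-nonneg = ℚ.nonNegative (ℚₚ.<⇒≤ 0<ε)
    d-nonneg : ℚ.NonNegative (qN (suc d))
    d-nonneg = ℚ.nonNegative (qN-nonneg (suc d))
    ¼-nonneg : ℚ.NonNegative ¼
    ¼-nonneg = _
  deviation : K * y - ¼ ≡ E * y
  deviation = begin-equality
      K * y - ¼                       ≡⟨ cong (λ k → k * y - ¼) K≡ ⟩
      (¼ * qN (suc w) + E) * y - ¼    ≡⟨ solve 3 (λ q e y → (con ¼ :* q :+ e) :* y :- con ¼ := e :* y :+ con ¼ :* (q :* y :- con 1ℚ))
                                           refl (qN (suc w)) E y ⟩
      E * y + ¼ * (qN (suc w) * y - 1ℚ) ≡⟨ cong (λ t → E * y + ¼ * (t - 1ℚ)) (qN-inverse w) ⟩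
      E * y + ¼ * (1ℚ - 1ℚ)           ≡⟨ ℚₚ.+-identityʳ (E * y) ⟩
      E * y                           ∎
  0≤Ey : 0ℚ ℚ.≤ E * y
  0≤Ey = subst (ℚ._≤ E * y) (ℚₚ.*-zeroˡ y) (ℚₚ.*-monoʳ-≤-nonNeg y 0≤E)
  scaled : (E * y) * qN n ℚ.< ε * qN n
  scaled = begin-strict
      (E * y) * qN n                   ≤⟨ ℚₚ.*-monoʳ-≤-nonNeg (qN n) (ℚₚ.*-monoʳ-≤-nonNeg y E≤¼C) ⟩
      ((¼ * qN C) * y) * qN n          ≡⟨ solve 3 (λ c y m → ((con ¼ :* c) :* y) :* m := (con ¼ :* (m :* c)) :* y)
                                            refl (qN C) y (qN n) ⟩
      (¼ * (qN n * qN C)) * y          ≡⟨ cong (λ t → (¼ * t) * y) (sym (qN-* n C)) ⟩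
      (¼ * qN (n ℕ.* C)) * y           ≤⟨ ℚₚ.*-monoʳ-≤-nonNeg y (ℚₚ.*-monoˡ-≤-nonNeg ¼ (qN-mono nC≤3W)) ⟩
      (¼ * qN (3 ℕ.* suc w)) * y       ≡⟨ cong (λ t → (¼ * t) * y) (qN-* 3 (suc w)) ⟩
      (¼ * (qN 3 * qN (suc w))) * y    ≡⟨ solve 3 (λ t q y → (con ¼ :* (t :* q)) :* y := (con ¼ :* t) :* (q :* y))
                                            refl (qN 3) (qN (suc w)) y ⟩
      (¼ * qN 3) * (qN (suc w) * y)    ≡⟨ cong ((¼ * qN 3) *_) (qN-inverse w) ⟩
      (¼ * qN 3) * 1ℚ                  <⟨ toWitness {a? = (¼ * qN 3) * 1ℚ ℚₚ.<? 1ℚ} _ ⟩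
      1ℚ                               ≡⟨ sym (trans (ℚₚ.*-comm _ (qN (suc d))) (trans (cong (qN (suc d) *_) (sym (inverse-mkℚ d))) (qN-inverse d))) ⟩
      mkℚ (ℤ.+ 1) d (1-coprimeTo (suc d)) * qN (suc d)
                                       ≤⟨ ℚₚ.*-monoʳ-≤-nonNeg (qN (suc d)) 1/[d+1]≤ε ⟩
      ε * qN (suc d)                   ≤⟨ ℚₚ.*-monoˡ-≤-nonNeg ε (qN-mono d<n) ⟩
      ε * qN n                         ∎

archimedean : ∀ ε → 0ℚ ℚ.< ε → ∃ λ d → mkℚ (ℤ.+ 1) d (1-coprimeTo (suc d)) ℚ.≤ ε
archimedean (mkℚ (ℤ.+ suc p) d _) _ = d , ℚ.*≤* (ℤ.+≤+ (ℕₚ.*-monoˡ-≤ (suc d) (s≤s (z≤n {p}))))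
archimedean (mkℚ (ℤ.+ zero) d _) (ℚ.*<* (ℤ.+<+ ()))
archimedean (mkℚ ℤ.-[1+ p ] d _) (ℚ.*<* ())

ratio-G : ∀ n (R : Fin (nV n) → Fin (nV n) → ℚ) → (∀ u v → IsEffectiveResistance (G n) u v (R u v)) →
  ∀ ε d → mkℚ (ℤ.+ 1) d (1-coprimeTo (suc d)) ℚ.≤ ε → 0ℚ ℚ.< ε → suc d ≤ n → 1 ≤ n →
  ℚ.∣ divℕ (kirchhoff R) (wiener (G n)) - ¼ ∣ ℚ.< ε
ratio-G n R R-eff ε d 1/[d+1]≤ε 0<ε d<n 1≤n =
  ratio-close (kirchhoff R) ε (wiener (G n)) (pairCount n) n d (kirchhoff-excess n R R-eff 1≤n)
    (ℕₚ.≤-trans (ℕₚ.m≤m+n (n ℕ.* pairCount n) _) (ℕₚ.≤-reflexive (sym (wiener-vs-pairs n))))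
    (wiener-positive n) d<n 1/[d+1]≤ε 0<ε

theorem3p2 : (r : (n : ℕ) → Fin (nV n) → Fin (nV n) → ℚ)
    → (∀ n u v → IsEffectiveResistance (G n) u v (r n u v))
    → ∀ (ε : ℚ) → 0ℚ ℚ.< ε
    → ∃ λ N → ∀ n → N ≤ n → 1 ≤ n
    → ℚ.∣ divℕ (kirchhoff (r n)) (wiener (G n)) - (ℤ.+ 1 / 4) ∣ ℚ.< ε
theorem3p2 r r-eff ε 0<ε =
  suc d , λ n d<n 1≤n → ratio-G n (r n) (r-eff n) ε d 1/[d+1]≤ε 0<ε d<n 1≤n
  where
  d : ℕ
  d = proj₁ (archimedean ε 0<ε)
  1/[d+1]≤ε : mkℚ (ℤ.+ 1) d (1-coprimeTo (suc d)) ℚ.≤ ε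
  1/[d+1]≤ε = proj₂ (archimedean ε 0<ε)
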